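{- (a) Let $T$ be a tiling of the $n$-gon $P$ containing a diagonal $e=[s_1,s_2]$, and let $q$ be a vertex lying strictly between $s_1$ and $s_2$ going clockwise from $s_1$ to $s_2$. Then $\mathrm{Scott}(T)$ has a strand $y\leadsto z$ covering $q$ with $y\in\{s_1,s_1+1,\dots,q-1\}$ and $z\in\{q+1,\dots,s_2\}$ (all intervals taken clockwise). (b) Let $T,e,q$ and the strand $y\leadsto z$ be as in (a), and let $T'$ be a further tiling of $P$ containing a tile $Q$ such that $Q\cap e$ is one-dimensional and $q$ is a vertex of $Q$. If the Scott strand construction of $T'$ contains a strand $y\leadsto z$ (with the same $y,z$), then this strand is a long strand for $Q$.
   Context: Let $P$ be a convex polygon with vertices labelled $1,\dots,n$ ($n\ge3$) in clockwise order, labels modulo $n$. A tiling $T$ is a (possibly empty) set of pairwise non-crossing (in their interiors) diagonals; tiles are the closures of the components of $P$ minus the diagonals. Scott strand construction: for each tile $Q$ with vertices $q_1,\dots,q_r$ in clockwise order (indices mod $r$) and each $j$, draw inside $Q$ a strand segment parallel to $[q_{j-1},q_j]$, entering $Q$ through the side $[q_j,q_{j+1}]$ near $q_j$ and leaving $Q$ through the side $[q_{j-2},q_{j-1}]$ near $q_{j-1}$; if the entering side is a boundary edge of $P$ the segment starts at vertex $q_j$, and if the leaving side is a boundary edge it ends at vertex $q_{j-1}$. At a diagonal shared by two tiles, a segment leaving one tile near an endpoint $v$ is continued by the segment of the other tile entering near $v$. Concatenation gives strands $x\leadsto y$; $\mathrm{Scott}(T)$ is the permutation $x\mapsto y$.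 A strand is a long strand for a tile $Q$ if it uses one of the strand segments of $Q$. A strand $x\leadsto y$ covers a vertex $q$ if $x,q,y$ are distinct and occur in this clockwise cyclic order. -}

module Defs where

open import Data.Nat using (ℕ; zero; suc; _+_; _∸_; _≤_; _<_; _≤ᵇ_)
open import Data.Bool using (if_then_else_)
open import Data.Fin using (Fin; toℕ)
open import Data.Fin.Subset using (Subset; ∣_∣) renaming (_∈_ to _∈ˢ_)
open import Data.Product using (Σ; _×_; _,_; ∃)
open import Data.Sum using (_⊎_)
open import Data.List using (List)
open import Data.List.Membership.Propositional using () renaming (_∈_ to _∈ˡ_)
open import Data.List.Relation.Unary.All using (All)
open import Relation.Binary.PropositionalEquality using (_≡_; _≢_)
open import Relation.Nullary using (¬_)

-- Vertices of the n-gon are Fin n (label i here = label i+1 of the paper);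
-- vertex i+1 (mod n) follows vertex i clockwise.

cw : ∀ {n} → Fin n → Fin n → ℕ
cw {n} a b = if toℕ a ≤ᵇ toℕ b then toℕ b ∸ toℕ a else (n + toℕ b) ∸ toℕ a

StrictBetween : ∀ {n} → Fin n → Fin n → Fin n → Set
StrictBetween a x b = (0 < cw a x) × (cw a x < cw a b)

Covers : ∀ {n} → Fin n → Fin n → Fin n → Set
Covers x q y = StrictBetween x q y

-- y ∈ {a, a+1, ..., b-1} (clockwise)
InCO : ∀ {n} → Fin n → Fin n → Fin n → Set
InCO a b y = cw a y < cw a b

-- z ∈ {a+1, ..., b} (clockwise)
InOC : ∀ {n} → Fin n → Fin n → Fin n → Set
InOC a b z = (0 < cw a z) × (cw a z ≤ cw a b)

BdryCW : ∀ {n} → Fin n → Fin n → Set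
BdryCW a b = cw a b ≡ 1

IsDiagonal : ∀ {n} → Fin n → Fin n → Set
IsDiagonal a b = (a ≢ b) × (cw a b ≢ 1) × (cw b a ≢ 1)

Crosses : ∀ {n} → (Fin n × Fin n) → (Fin n × Fin n) → Set
Crosses (a , b) (c , d) =
  (a ≢ c) × (a ≢ d) × (b ≢ c) × (b ≢ d) ×
  ((StrictBetween a c b × StrictBetween b d a) ⊎ (StrictBetween a d b × StrictBetween b c a))

-- a tiling: a finite set (list) of pairwise non-crossing diagonals
Tiling : ℕ → Set
Tiling n = List (Fin n × Fin n)

IsTiling : ∀ {n} → Tiling n → Set
IsTiling T =
  All (λ e → IsDiagonal (Data.Product.proj₁ e) (Data.Product.proj₂ e)) T ×
  (∀ e f → e ∈ˡ T → f ∈ˡ T → ¬ Crosses e f)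

InT : ∀ {n} → Tiling n → Fin n → Fin n → Set
InT T a b = ((a , b) ∈ˡ T) ⊎ ((b , a) ∈ˡ T)

NextIn : ∀ {n} → Subset n → Fin n → Fin n → Set
NextIn Q a b =
  (a ∈ˢ Q) × (b ∈ˢ Q) × (a ≢ b) ×
  (∀ u → u ∈ˢ Q → (cw a u ≡ 0) ⊎ (cw a b ≤ cw a u))

-- Q (given by its vertex set) is a tile of T: at least 3 vertices, every side
-- of conv(Q) is a boundary edge or a diagonal of T, and no diagonal of T joins
-- two vertices of Q other than a side (so no diagonal of T meets int conv(Q)).
IsTile : ∀ {n} → Tiling n → Subset n → Set
IsTile T Q =
  (3 ≤ ∣ Q ∣) ×
  (∀ a b → NextIn Q a b → BdryCW a b ⊎ InT T a b) ×
  (∀ a b → a ∈ˢ Q → b ∈ˢ Q → InT T a b → NextIn Q a b ⊎ NextIn Q b a)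

-- A segment is given by a tile Q and a vertex v = q_j of Q:
-- it enters Q through the side [v, succ v] near v and leaves through the side
-- [pp, p] near p, where p = pred v, pp = pred p (in Q, clockwise).
-- Path T Q v y : the strand continuing from segment (Q, v) ends at vertex y.
data Path {n} (T : Tiling n) : Subset n → Fin n → Fin n → Set where
  stop : ∀ {Q v p pp} → NextIn Q p v → NextIn Q pp p → BdryCW pp p →
         Path T Q v p
  step : ∀ {Q v p pp Q' y} → NextIn Q p v → NextIn Q pp p → InT T pp p →
         IsTile T Q' → NextIn Q' p pp → Path T Q' p y → Path T Q v y

-- a strand x ⇝ y of Scott(T): starts at vertex x in the tile having the
-- boundary edge [x, x+1] as a side
record Strand {n} (T : Tiling n) (x y : Fin n) : Set where
  constructor strand
  field
    tile     : Subset n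
    isTile   : IsTile T tile
    next     : Fin n
    nextIn   : NextIn tile x next
    boundary : BdryCW x next
    path     : Path T tile x y

UsesP : ∀ {n} {T : Tiling n} {Q₀ v y} → Path T Q₀ v y → Subset n → Set
UsesP {Q₀ = Q₀} (stop _ _ _) Q = Q₀ ≡ Q
UsesP {Q₀ = Q₀} (step _ _ _ _ _ r) Q = (Q₀ ≡ Q) ⊎ UsesP r Q

LongFor : ∀ {n} {T : Tiling n} {x y} → Strand T x y → Subset n → Set
LongFor σ Q = UsesP (Strand.path σ) Q

-- Q ∩ [s₁,s₂] is one-dimensional (Q a convex polygon on vertices of P):
-- either both s₁, s₂ are vertices of Q, or Q has vertices strictly on both
-- sides of the line through s₁, s₂.
MeetsInSegment : ∀ {n} → Subset n → Fin n → Fin n → Set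
MeetsInSegment Q s₁ s₂ =
  ((s₁ ∈ˢ Q) × (s₂ ∈ˢ Q)) ⊎
  (Σ (Fin _) λ u → Σ (Fin _) λ w →
     (u ∈ˢ Q) × (w ∈ˢ Q) × StrictBetween s₁ u s₂ × StrictBetween s₂ w s₁)

module Submission where

-- Measuring positions clockwise from a suitable base vertex turns the cyclic order into the order of ℕ.
--
-- (a) Induction on the length of the diagonal s₁ s₂. Let P be the tile of T with side s₂ → s₁, lying on
-- the arc from s₁ to s₂. If q is a vertex of P, the strand through the segment of P at s₁ enters P
-- through its side at s₁ and leaves through its side at s₂, so it covers q within [s₁, s₂]. Otherwise q
-- lies behind a side c d of P, a shorter diagonal of T, and the strand found for c d will do.
--
-- (b) Follow the strand y ⇝ z of T' from tile to tile. A tile Q of T' other than the current one lies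
-- behind a single side of it. Q has a vertex inside the arc covered by the strand (namely q) and one
-- outside (s₁, or a vertex beyond s₂), so that side must be the one the strand leaves by; hence the
-- strand cannot leave the polygon before passing through Q.

open import Defs
open import Data.Nat using (ℕ; _≤_)
open import Data.Fin using (Fin)
open import Data.Fin.Subset using (Subset) renaming (_∈_ to _∈ˢ_)
open import Data.Product using (Σ; _×_)

open import Data.Nat
open import Data.Nat.Properties
import Data.Bool as Bool
open import Data.Bool using (true; false)
open import Data.Fin using (toℕ; fromℕ<)
open import Data.Fin.Properties using (toℕ<n; toℕ-injective; toℕ-fromℕ<)
import Data.Fin.Properties as Fin
open import Data.Fin.Subset using (∣_∣; ⁅_⁆; _∪_; _⊆_)
open import Data.Fin.Subset.Properties
  using (_∈?_; ⊆-antisym; x∈p∧x≢y⇒x∈p-y; x∈p⇒∣p-x∣<∣p∣; p⊆q⇒∣p∣≤∣q∣; x∈p∪q⁺; x∈⁅x⁆; ∣⁅x⁆∣≡1)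
open import Data.Vec using ([]; _∷_; tabulate; lookup)
import Data.Vec.Properties as Vec
import Data.List.Relation.Unary.All as All
open import Data.Product using (_,_; proj₁; proj₂)
import Data.Product.Properties as Product
open import Data.Sum using (_⊎_; inj₁; inj₂; swap)
open import Data.Empty using (⊥; ⊥-elim)
open import Data.Unit using (tt)
open import Relation.Binary.PropositionalEquality
open import Relation.Nullary using (¬_; yes; no; Dec; does)
open import Relation.Nullary.Decidable using (_×-dec_; _⊎-dec_; ¬?; toWitness; dec-true; isYes; isYes≗does)
open import Relation.Unary using (Decidable)
open import Function using (_∘_)
open import Relation.Binary.Definitions using (tri<; tri≈; tri>)
open ≡-Reasoning

-- Clockwise distance

module _ {n : ℕ} where

  cw-≤ : (a b : Fin n) → toℕ a ≤ toℕ b → cw a b ≡ toℕ b ∸ toℕ a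
  cw-≤ a b a≤b with toℕ a ≤ᵇ toℕ b | ≤⇒≤ᵇ a≤b
  ... | true | _ = refl

  cw-> : (a b : Fin n) → toℕ b < toℕ a → cw a b ≡ n + toℕ b ∸ toℕ a
  cw-> a b b<a with toℕ a ≤ᵇ toℕ b in eq
  ... | false = refl
  ... | true = ⊥-elim (<⇒≱ b<a (≤ᵇ⇒≤ (toℕ a) (toℕ b) (subst Bool.T (sym eq) _)))

  -- Both branches have the shape  cw a b + a ≡ b + k  (k ∈ {0, n}), so that cw-triangle can combine
  -- three of them with the single arithmetic lemma offsets-compose.
  cw-cases : (a b : Fin n) →
    (toℕ a ≤ toℕ b × cw a b + toℕ a ≡ toℕ b + 0) ⊎ (toℕ b < toℕ a × cw a b + toℕ a ≡ toℕ b + n)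
  cw-cases a b with toℕ a ≤? toℕ b
  ... | yes a≤b = inj₁ (a≤b , (begin
    cw a b + toℕ a          ≡⟨ cong (_+ toℕ a) (cw-≤ a b a≤b) ⟩
    toℕ b ∸ toℕ a + toℕ a   ≡⟨ m∸n+n≡m a≤b ⟩
    toℕ b                   ≡⟨ +-identityʳ (toℕ b) ⟨
    toℕ b + 0               ∎))
  ... | no a≰b = inj₂ (≰⇒> a≰b , (begin
    cw a b + toℕ a          ≡⟨ cong (_+ toℕ a) (cw-> a b (≰⇒> a≰b)) ⟩
    n + toℕ b ∸ toℕ a + toℕ a ≡⟨ m∸n+n≡m (≤-trans (<⇒≤ (toℕ<n a)) (m≤m+n n (toℕ b))) ⟩
    n + toℕ b               ≡⟨ +-comm n (toℕ b) ⟩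
    toℕ b + n               ∎))

  cw<n : (a b : Fin n) → cw a b < n
  cw<n a b with cw-cases a b
  ... | inj₁ (_ , e) =
    ≤-<-trans (≤-trans (m≤m+n (cw a b) (toℕ a)) (≤-reflexive (trans e (+-identityʳ _)))) (toℕ<n b)
  ... | inj₂ (b<a , e) = +-cancelʳ-< (toℕ a) (cw a b) n
    (subst₂ _<_ (sym e) (+-comm (toℕ a) n) (+-monoˡ-< n b<a))

  cw-refl : (a : Fin n) → cw a a ≡ 0
  cw-refl a = trans (cw-≤ a a ≤-refl) (n∸n≡0 (toℕ a))

  cw≡0⇒≡ : {a b : Fin n} → cw a b ≡ 0 → a ≡ b
  cw≡0⇒≡ {a} {b} e with cw-cases a b
  ... | inj₁ (_ , e') = toℕ-injective (trans (sym (cong (_+ toℕ a) e)) (trans e' (+-identityʳ _)))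
  ... | inj₂ (_ , e') = ⊥-elim (<⇒≱ (toℕ<n a)
    (subst (n ≤_) (trans (sym e') (cong (_+ toℕ a) e)) (m≤n+m n (toℕ b))))

  ≢⇒0<cw : {a b : Fin n} → a ≢ b → 0 < cw a b
  ≢⇒0<cw {a} {b} a≢b with cw a b in eq
  ... | zero = ⊥-elim (a≢b (cw≡0⇒≡ eq))
  ... | suc _ = s≤s z≤n

  cw-surjective : (r : Fin n) (k : ℕ) → k < n → Σ (Fin n) λ m → cw r m ≡ k
  cw-surjective r k k<n with toℕ r + k <? n
  ... | yes r+k<n = m , (begin
    cw r m                 ≡⟨ cw-≤ r m (subst (toℕ r ≤_) (sym (toℕ-fromℕ< r+k<n)) (m≤m+n (toℕ r) k)) ⟩
    toℕ m ∸ toℕ r          ≡⟨ cong (_∸ toℕ r) (toℕ-fromℕ< r+k<n) ⟩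
    toℕ r + k ∸ toℕ r      ≡⟨ m+n∸m≡n (toℕ r) k ⟩
    k                      ∎)
    where
    m = fromℕ< r+k<n
  ... | no r+k≮n = m , (begin
    cw r m                       ≡⟨ cw-> r m m<r ⟩
    n + toℕ m ∸ toℕ r            ≡⟨ cong (λ i → n + i ∸ toℕ r) (toℕ-fromℕ< m<n) ⟩
    n + (toℕ r + k ∸ n) ∸ toℕ r  ≡⟨ cong (_∸ toℕ r) (m+[n∸m]≡n n≤r+k) ⟩
    toℕ r + k ∸ toℕ r            ≡⟨ m+n∸m≡n (toℕ r) k ⟩
    k                            ∎)
    where
    n≤r+k : n ≤ toℕ r + k
    n≤r+k = ≮⇒≥ r+k≮n
    m<n : toℕ r + k ∸ n < n
    m<n = +-cancelʳ-< n (toℕ r + k ∸ n) n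
      (subst (_< n + n) (sym (m∸n+n≡m n≤r+k)) (+-mono-< (toℕ<n r) k<n))
    m = fromℕ< m<n
    m<r : toℕ m < toℕ r
    m<r = subst (_< toℕ r) (sym (toℕ-fromℕ< m<n)) (+-cancelʳ-< n (toℕ r + k ∸ n) (toℕ r)
      (subst (_< toℕ r + n) (sym (m∸n+n≡m n≤r+k)) (+-monoʳ-< (toℕ r) k<n)))

  private
    offsets-compose : ∀ c X Y i px R j py k m → c + X ≡ Y + i → px + R ≡ X + j → py + R ≡ Y + k →
      i + j ≡ k + m → c + px ≡ py + m
    offsets-compose c X Y i px R j py k m e₁ e₂ e₃ e₄ = +-cancelʳ-≡ R (c + px) (py + m) (begin
      c + px + R      ≡⟨ +-assoc c px R ⟩
      c + (px + R)    ≡⟨ cong (c +_) e₂ ⟩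
      c + (X + j)     ≡⟨ +-assoc c X j ⟨
      c + X + j       ≡⟨ cong (_+ j) e₁ ⟩
      Y + i + j       ≡⟨ +-assoc Y i j ⟩
      Y + (i + j)     ≡⟨ cong (Y +_) e₄ ⟩
      Y + (k + m)     ≡⟨ +-assoc Y k m ⟨
      Y + k + m       ≡⟨ cong (_+ m) e₃ ⟨
      py + R + m      ≡⟨ +-assoc py R m ⟩
      py + (R + m)    ≡⟨ cong (py +_) (+-comm R m) ⟩
      py + (m + R)    ≡⟨ +-assoc py m R ⟨
      py + m + R      ∎)

  cw-triangle : (r x y : Fin n) → (cw x y + cw r x ≡ cw r y) ⊎ (cw x y + cw r x ≡ cw r y + n)
  cw-triangle r x y with cw-cases x y | cw-cases r x | cw-cases r y
  ... | inj₁ (_ , e₁) | inj₁ (_ , e₂) | inj₁ (_ , e₃) =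
    inj₁ (trans (offsets-compose _ _ _ 0 _ _ 0 _ 0 0 e₁ e₂ e₃ refl) (+-identityʳ _))
  ... | inj₁ (x≤y , _) | inj₁ (r≤x , _) | inj₂ (y<r , _) = ⊥-elim (<⇒≱ y<r (≤-trans r≤x x≤y))
  ... | inj₁ (_ , e₁) | inj₂ (_ , e₂) | inj₁ (_ , e₃) =
    inj₂ (offsets-compose _ _ _ 0 _ _ n _ 0 n e₁ e₂ e₃ refl)
  ... | inj₁ (_ , e₁) | inj₂ (_ , e₂) | inj₂ (_ , e₃) =
    inj₁ (trans (offsets-compose _ _ _ 0 _ _ n _ n 0 e₁ e₂ e₃ (sym (+-identityʳ n))) (+-identityʳ _))
  ... | inj₂ (_ , e₁) | inj₁ (_ , e₂) | inj₁ (_ , e₃) =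
    inj₂ (offsets-compose _ _ _ n _ _ 0 _ 0 n e₁ e₂ e₃ (+-identityʳ n))
  ... | inj₂ (_ , e₁) | inj₁ (_ , e₂) | inj₂ (_ , e₃) =
    inj₁ (trans (offsets-compose _ _ _ n _ _ 0 _ n 0 e₁ e₂ e₃ refl) (+-identityʳ _))
  ... | inj₂ (y<x , _) | inj₂ (x<r , _) | inj₁ (r≤y , _) = ⊥-elim (<⇒≱ (<-trans y<x x<r) r≤y)
  ... | inj₂ (_ , e₁) | inj₂ (_ , e₂) | inj₂ (_ , e₃) =
    inj₂ (offsets-compose _ _ _ n _ _ n _ n n e₁ e₂ e₃ refl)

  cw-trans : (r x y : Fin n) → cw r x ≤ cw r y → cw x y + cw r x ≡ cw r y
  cw-trans r x y rx≤ry with cw-triangle r x y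
  ... | inj₁ e = e
  ... | inj₂ e = ⊥-elim (<⇒≱ (cw<n x y) (+-cancelʳ-≤ (cw r x) n (cw x y)
    (subst₂ _≤_ (+-comm (cw r x) n) (sym e) (+-monoˡ-≤ n rx≤ry))))

  cw-trans-wrap : (r x y : Fin n) → cw r y < cw r x → cw x y + cw r x ≡ cw r y + n
  cw-trans-wrap r x y ry<rx with cw-triangle r x y
  ... | inj₂ e = e
  ... | inj₁ e = ⊥-elim (<⇒≱ ry<rx (subst (cw r x ≤_) e (m≤n+m (cw r x) (cw x y))))

  cw-injective : (r : Fin n) {x y : Fin n} → cw r x ≡ cw r y → x ≡ y
  cw-injective r {x} {y} e =
    cw≡0⇒≡ (+-cancelʳ-≡ (cw r x) (cw x y) 0 (trans (cw-trans r x y (≤-reflexive e)) (sym e)))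

  cw+cw≡n : {a b : Fin n} → a ≢ b → cw a b + cw b a ≡ n
  cw+cw≡n {a} {b} a≢b = begin
    cw a b + cw b a   ≡⟨ +-comm (cw a b) (cw b a) ⟩
    cw b a + cw a b   ≡⟨ cw-trans-wrap a b a (subst (_< cw a b) (sym (cw-refl a)) (≢⇒0<cw a≢b)) ⟩
    cw a a + n        ≡⟨ cong (_+ n) (cw-refl a) ⟩
    n                 ∎

module _ {n : ℕ} (r : Fin n) where

  arc⇒between : ∀ {a b u : Fin n} → cw r a ≤ cw r b → cw a u ≤ cw a b →
                cw r a ≤ cw r u × cw r u ≤ cw r b
  arc⇒between {a} {b} {u} ra≤rb au≤ab with ≤-total (cw r a) (cw r u)
  ... | inj₁ ra≤ru = ra≤ru , subst₂ _≤_ (cw-trans r a u ra≤ru) (cw-trans r a b ra≤rb) (+-monoˡ-≤ (cw r a) au≤ab)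
  ... | inj₂ ru≤ra with cw r u ≟ cw r a
  ...   | yes e = ≤-reflexive (sym e) , ≤-trans (≤-reflexive e) ra≤rb
  ...   | no ne = ⊥-elim (<⇒≱ (cw<n r b) (≤-trans (m≤n+m n (cw r u))
          (subst₂ _≤_ (cw-trans-wrap r a u (≤∧≢⇒< ru≤ra ne)) (cw-trans r a b ra≤rb) (+-monoˡ-≤ (cw r a) au≤ab))))

  between⇒arc : ∀ {a b u : Fin n} → cw r a ≤ cw r u → cw r u ≤ cw r b → cw a u ≤ cw a b
  between⇒arc {a} {b} {u} ra≤ru ru≤rb = +-cancelʳ-≤ (cw r a) (cw a u) (cw a b)
    (subst₂ _≤_ (sym (cw-trans r a u ra≤ru)) (sym (cw-trans r a b (≤-trans ra≤ru ru≤rb))) ru≤rb)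

  <<⇒StrictBetween : ∀ {x y z : Fin n} → cw r x < cw r y → cw r y < cw r z → StrictBetween x y z
  <<⇒StrictBetween {x} {y} {z} rx<ry ry<rz =
    +-cancelʳ-< (cw r x) 0 (cw x y) (subst (cw r x <_) (sym xy) rx<ry) ,
    +-cancelʳ-< (cw r x) (cw x y) (cw x z) (subst₂ _<_ (sym xy) (sym (cw-trans r x z (<⇒≤ (<-trans rx<ry ry<rz)))) ry<rz)
    where xy = cw-trans r x y (<⇒≤ rx<ry)

  <<⇒StrictBetween-wrap : ∀ {x y z : Fin n} → cw r z < cw r x → cw r x < cw r y → StrictBetween x y z
  <<⇒StrictBetween-wrap {x} {y} {z} rz<rx rx<ry =
    +-cancelʳ-< (cw r x) 0 (cw x y) (subst (cw r x <_) (sym xy) rx<ry) ,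
    +-cancelʳ-< (cw r x) (cw x y) (cw x z) (subst₂ _<_ (sym xy) (sym (cw-trans-wrap r x z rz<rx))
      (<-≤-trans (cw<n r y) (m≤n+m n (cw r z))))
    where xy = cw-trans r x y (<⇒≤ rx<ry)

  NextIn⇒≤ : ∀ {Q : Subset n} {c d t : Fin n} → NextIn Q c d → cw r c < cw r d →
             t ∈ˢ Q → cw r c < cw r t → cw r d ≤ cw r t
  NextIn⇒≤ {c = c} {d} {t} (_ , _ , _ , after) rc<rd tQ rc<rt with after t tQ
  ... | inj₁ e = ⊥-elim (<⇒≢ rc<rt (cong (cw r) (cw≡0⇒≡ e)))
  ... | inj₂ cd≤ct = subst₂ _≤_ (cw-trans r c d (<⇒≤ rc<rd)) (cw-trans r c t (<⇒≤ rc<rt)) (+-monoˡ-≤ (cw r c) cd≤ct)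

  NextIn⇒< : ∀ {Q : Subset n} {c d x : Fin n} → NextIn Q c d → x ∈ˢ Q → cw r c < cw r x → cw r c < cw r d
  NextIn⇒< {c = c} {d} {x} (_ , _ , c≢d , after) xQ rc<rx with <-cmp (cw r c) (cw r d)
  ... | tri< rc<rd _ _ = rc<rd
  ... | tri≈ _ e _ = ⊥-elim (c≢d (cw-injective r e))
  ... | tri> _ _ rd<rc with after x xQ
  ...   | inj₁ e = ⊥-elim (<⇒≢ rc<rx (cong (cw r) (cw≡0⇒≡ e)))
  ...   | inj₂ cd≤cx = ⊥-elim (<⇒≱ (cw<n r x) (≤-trans (m≤n+m n (cw r d))
          (subst₂ _≤_ (cw-trans-wrap r c d rd<rc) (cw-trans r c x (<⇒≤ rc<rx)) (+-monoˡ-≤ (cw r c) cd≤cx))))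

  ≤⇒NextIn : ∀ {Q : Subset n} {c d : Fin n} → c ∈ˢ Q → d ∈ˢ Q → cw r c < cw r d →
             (∀ t → t ∈ˢ Q → cw r c < cw r t → cw r d ≤ cw r t) → NextIn Q c d
  ≤⇒NextIn {Q} {c} {d} cQ dQ rc<rd least = cQ , dQ , (λ e → <⇒≢ rc<rd (cong (cw r) e)) , after
    where
    after : ∀ t → t ∈ˢ Q → (cw c t ≡ 0) ⊎ (cw c d ≤ cw c t)
    after t tQ with <-cmp (cw r c) (cw r t)
    ... | tri< rc<rt _ _ = inj₂ (between⇒arc (<⇒≤ rc<rd) (least t tQ rc<rt))
    ... | tri≈ _ e _ = inj₁ (trans (cong (cw c) (cw-injective r (sym e))) (cw-refl c))
    ... | tri> _ _ rt<rc = inj₂ (+-cancelʳ-≤ (cw r c) (cw c d) (cw c t)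
      (subst₂ _≤_ (sym (cw-trans r c d (<⇒≤ rc<rd))) (sym (cw-trans-wrap r c t rt<rc))
        (≤-trans (<⇒≤ (cw<n r d)) (m≤n+m n (cw r t)))))

module _ {n : ℕ} where

  StrictBetween⇒cw< : ∀ {a b x : Fin n} → StrictBetween b x a → cw a b < cw a x
  StrictBetween⇒cw< {a} {b} {x} (0<bx , bx<ba) with cw-triangle a b x
  ... | inj₁ e = subst (cw a b <_) e (+-monoˡ-< (cw a b) 0<bx)
  ... | inj₂ e = ⊥-elim (<-irrefl refl (≤-<-trans (≤-trans (m≤n+m n (cw a x)) (≤-reflexive (sym e)))
    (<-≤-trans (+-monoˡ-< (cw a b) bx<ba) (≤-reflexive (trans (+-comm (cw b a) (cw a b)) (cw+cw≡n a≢b))))))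
    where
    a≢b : a ≢ b
    a≢b e = 1+n≰n (≤-trans (<-trans 0<bx bx<ba) (≤-reflexive (trans (cong (cw b) e) (cw-refl b))))

  cw<⇒StrictBetween : ∀ {a b x : Fin n} → b ≢ a → cw a b < cw a x → StrictBetween b x a
  cw<⇒StrictBetween {a} {b} {x} b≢a ab<ax =
    +-cancelʳ-< (cw a b) 0 (cw b x) (subst (cw a b <_) (sym bx) ab<ax) ,
    +-cancelʳ-< (cw a b) (cw b x) (cw b a) (subst₂ _<_ (sym bx) (sym ba) (cw<n a x))
    where
    bx : cw b x + cw a b ≡ cw a x
    bx = cw-trans a b x (<⇒≤ ab<ax)
    ba : cw b a + cw a b ≡ n
    ba = trans (+-comm (cw b a) (cw a b)) (cw+cw≡n (λ e → b≢a (sym e)))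

-- Vertex sets of convex polygons

module _ {n : ℕ} {P : Fin n → Set} (P? : Decidable P) (f : Fin n → ℕ) where

  private
    argmin-fuel : (k : ℕ) (u : Fin n) → P u → f u < k → Σ (Fin n) λ m → P m × (∀ v → P v → f m ≤ f v)
    argmin-fuel (suc k) u pu fu≤k with Fin.any? (λ v → P? v ×-dec (f v <? f u))
    ... | yes (v , pv , fv<fu) = argmin-fuel k v pv (<-≤-trans fv<fu (s≤s⁻¹ fu≤k))
    ... | no none = u , pu , λ v pv → ≮⇒≥ (λ fv<fu → none (v , pv , fv<fu))

    argmax-fuel : (B : ℕ) → (∀ v → P v → f v ≤ B) → (k : ℕ) (u : Fin n) → P u → B ∸ f u < k →
                  Σ (Fin n) λ m → P m × (∀ v → P v → f v ≤ f m)
    argmax-fuel B bound (suc k) u pu gap≤k with Fin.any? (λ v → P? v ×-dec (f u <? f v))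
    ... | yes (v , pv , fu<fv) = argmax-fuel B bound k v pv (<-≤-trans (∸-monoʳ-< fu<fv (bound v pv)) (s≤s⁻¹ gap≤k))
    ... | no none = u , pu , λ v pv → ≮⇒≥ (λ fu<fv → none (v , pv , fu<fv))

  argmin : (u : Fin n) → P u → Σ (Fin n) λ m → P m × (∀ v → P v → f m ≤ f v)
  argmin u pu = argmin-fuel (suc (f u)) u pu ≤-refl

  argmax : (B : ℕ) → (∀ v → P v → f v ≤ B) → (u : Fin n) → P u → Σ (Fin n) λ m → P m × (∀ v → P v → f v ≤ f m)
  argmax B bound u pu = argmax-fuel B bound (suc (B ∸ f u)) u pu ≤-refl

∣p∪q∣≤∣p∣+∣q∣ : ∀ {m} (p q : Subset m) → ∣ p ∪ q ∣ ≤ ∣ p ∣ + ∣ q ∣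
∣p∪q∣≤∣p∣+∣q∣ [] [] = z≤n
∣p∪q∣≤∣p∣+∣q∣ (true ∷ p) (true ∷ q) =
  s≤s (≤-trans (∣p∪q∣≤∣p∣+∣q∣ p q) (≤-trans (m≤n+m _ 1) (≤-reflexive (sym (+-suc ∣ p ∣ ∣ q ∣)))))
∣p∪q∣≤∣p∣+∣q∣ (true ∷ p) (false ∷ q) = s≤s (∣p∪q∣≤∣p∣+∣q∣ p q)
∣p∪q∣≤∣p∣+∣q∣ (false ∷ p) (true ∷ q) = ≤-trans (s≤s (∣p∪q∣≤∣p∣+∣q∣ p q)) (≤-reflexive (sym (+-suc ∣ p ∣ ∣ q ∣)))
∣p∪q∣≤∣p∣+∣q∣ (false ∷ p) (false ∷ q) = ∣p∪q∣≤∣p∣+∣q∣ p q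

module _ {n : ℕ} where

  3≤∣p∣ : ∀ {p : Subset n} {x y z : Fin n} → x ∈ˢ p → y ∈ˢ p → z ∈ˢ p → x ≢ y → x ≢ z → y ≢ z → 3 ≤ ∣ p ∣
  3≤∣p∣ xp yp zp x≢y x≢z y≢z =
    ≤-trans (s≤s (≤-trans (s≤s (≤-trans (s≤s z≤n) (x∈p⇒∣p-x∣<∣p∣ z∈p-x-y))) (x∈p⇒∣p-x∣<∣p∣ y∈p-x))) (x∈p⇒∣p-x∣<∣p∣ xp)
    where
    z∈p-x-y = x∈p∧x≢y⇒x∈p-y (x∈p∧x≢y⇒x∈p-y zp (≢-sym x≢z)) (≢-sym y≢z)
    y∈p-x = x∈p∧x≢y⇒x∈p-y yp (≢-sym x≢y)

  3≤∣p∣⇒∃-third : ∀ (p : Subset n) → 3 ≤ ∣ p ∣ → (c d : Fin n) → Σ (Fin n) λ t → t ∈ˢ p × t ≢ c × t ≢ d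
  3≤∣p∣⇒∃-third p 3≤∣p∣ c d with Fin.any? (λ t → (t ∈? p) ×-dec (¬? (t Fin.≟ c) ×-dec ¬? (t Fin.≟ d)))
  ... | yes found = found
  ... | no none = ⊥-elim (<⇒≱ 3≤∣p∣ (≤-trans (p⊆q⇒∣p∣≤∣q∣ p⊆cd) (≤-trans (∣p∪q∣≤∣p∣+∣q∣ ⁅ c ⁆ ⁅ d ⁆)
    (≤-reflexive (cong₂ _+_ (∣⁅x⁆∣≡1 c) (∣⁅x⁆∣≡1 d))))))
    where
    p⊆cd : p ⊆ ⁅ c ⁆ ∪ ⁅ d ⁆
    p⊆cd {t} tp with t Fin.≟ c | t Fin.≟ d
    ... | yes refl | _ = x∈p∪q⁺ (inj₁ (x∈⁅x⁆ t))
    ... | no _ | yes refl = x∈p∪q⁺ (inj₂ (x∈⁅x⁆ t))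
    ... | no t≢c | no t≢d = ⊥-elim (none (t , tp , t≢c , t≢d))

  source∈ : ∀ {Q : Subset n} {a b : Fin n} → NextIn Q a b → a ∈ˢ Q
  source∈ = proj₁

  target∈ : ∀ {Q : Subset n} {a b : Fin n} → NextIn Q a b → b ∈ˢ Q
  target∈ = proj₁ ∘ proj₂

  source≢target : ∀ {Q : Subset n} {a b : Fin n} → NextIn Q a b → a ≢ b
  source≢target = proj₁ ∘ proj₂ ∘ proj₂

  target-nearest : ∀ {Q : Subset n} {a b : Fin n} → NextIn Q a b → ∀ u → u ∈ˢ Q → (cw a u ≡ 0) ⊎ (cw a b ≤ cw a u)
  target-nearest = proj₂ ∘ proj₂ ∘ proj₂

  NextIn-exists : ∀ (Q : Subset n) {a t : Fin n} → a ∈ˢ Q → t ∈ˢ Q → t ≢ a → Σ (Fin n) λ b → NextIn Q a b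
  NextIn-exists Q {a} {t} aQ tQ t≢a with argmin (λ v → (v ∈? Q) ×-dec ¬? (v Fin.≟ a)) (cw a) t (tQ , t≢a)
  ... | b , (bQ , b≢a) , least = b , aQ , bQ , ≢-sym b≢a , after
    where
    after : ∀ u → u ∈ˢ Q → (cw a u ≡ 0) ⊎ (cw a b ≤ cw a u)
    after u uQ with u Fin.≟ a
    ... | yes refl = inj₁ (cw-refl a)
    ... | no u≢a = inj₂ (least u (uQ , u≢a))

  NextIn-exists⁻ : ∀ (Q : Subset n) {b t : Fin n} → b ∈ˢ Q → t ∈ˢ Q → t ≢ b → Σ (Fin n) λ a → NextIn Q a b
  NextIn-exists⁻ Q {b} {t} bQ tQ t≢b with argmin (λ v → (v ∈? Q) ×-dec ¬? (v Fin.≟ b)) (λ v → cw v b) t (tQ , t≢b)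
  ... | a , (aQ , a≢b) , least = a , aQ , bQ , a≢b , after
    where
    after : ∀ u → u ∈ˢ Q → (cw a u ≡ 0) ⊎ (cw a b ≤ cw a u)
    after u uQ with u Fin.≟ a | u Fin.≟ b
    ... | yes refl | _ = inj₁ (cw-refl a)
    ... | no _ | yes refl = inj₂ ≤-refl
    ... | no u≢a | no u≢b with ≤-total (cw a b) (cw a u)
    ...   | inj₁ ab≤au = inj₂ ab≤au
    ...   | inj₂ au≤ab = ⊥-elim (<⇒≱ ub<ab (least u (uQ , u≢b)))
      where
      ub<ab : cw u b < cw a b
      ub<ab = subst (cw u b <_) (cw-trans a u b au≤ab) (m<m+n (cw u b) (≢⇒0<cw (≢-sym u≢a)))

  NextIn-functional : ∀ {Q : Subset n} {a b b' : Fin n} → NextIn Q a b → NextIn Q a b' → b ≡ b'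
  NextIn-functional {a = a} {b} {b'} (_ , bQ , a≢b , after) (_ , b'Q , a≢b' , after') with after b' b'Q | after' b bQ
  ... | inj₁ e | _ = ⊥-elim (a≢b' (cw≡0⇒≡ e))
  ... | inj₂ _ | inj₁ e = ⊥-elim (a≢b (cw≡0⇒≡ e))
  ... | inj₂ ab≤ab' | inj₂ ab'≤ab = cw-injective a (≤-antisym ab≤ab' ab'≤ab)

  NextIn-injective : ∀ {Q : Subset n} {a a' b : Fin n} → NextIn Q a b → NextIn Q a' b → a ≡ a'
  NextIn-injective {a = a} {a'} {b} (aQ , _ , a≢b , after) (a'Q , _ , a'≢b , after') with a Fin.≟ a'
  ... | yes e = e
  ... | no a≢a' with after a' a'Q | after' a aQ
  ...   | inj₁ e | _ = ⊥-elim (a≢a' (cw≡0⇒≡ e))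
  ...   | inj₂ _ | inj₁ e = ⊥-elim (a≢a' (sym (cw≡0⇒≡ e)))
  ...   | inj₂ ab≤aa' | inj₂ a'b≤a'a = ⊥-elim (<⇒≱ a'a<a'b a'b≤a'a)
    where
    ab<aa' : cw a b < cw a a'
    ab<aa' = ≤∧≢⇒< ab≤aa' (λ e → a'≢b (sym (cw-injective a e)))
    a'a<a'b : cw a' a < cw a' b
    a'a<a'b = +-cancelʳ-< (cw a a') (cw a' a) (cw a' b) (subst₂ _<_
      (sym (trans (+-comm (cw a' a) (cw a a')) (cw+cw≡n a≢a'))) (sym (cw-trans-wrap a a' b ab<aa'))
      (m<n+m n (≢⇒0<cw a≢b)))

  NextIn⇒¬StrictBetween : ∀ {Q : Subset n} {c d u : Fin n} → NextIn Q c d → u ∈ˢ Q → ¬ StrictBetween c u d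
  NextIn⇒¬StrictBetween (_ , _ , _ , after) uQ (0<cu , cu<cd) with after _ uQ
  ... | inj₁ e = <⇒≢ 0<cu (sym e)
  ... | inj₂ cd≤cu = <⇒≱ cu<cd cd≤cu

  NextIn⇒arc : ∀ {Q : Subset n} {v w u : Fin n} → NextIn Q v w → u ∈ˢ Q → cw w u ≤ cw w v
  NextIn⇒arc {v = v} {w} {u} (_ , _ , v≢w , after) uQ with after u uQ
  ... | inj₁ e = ≤-reflexive (cong (cw w) (sym (cw≡0⇒≡ e)))
  ... | inj₂ vw≤vu = +-cancelʳ-≤ (cw v w) (cw w u) (cw w v) (subst₂ _≤_ (sym (cw-trans v w u vw≤vu))
    (sym (trans (+-comm (cw w v) (cw v w)) (cw+cw≡n v≢w))) (<⇒≤ (cw<n v u)))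

  NextIn⇒between : ∀ (r : Fin n) {Q : Subset n} {v w u : Fin n} → NextIn Q v w → cw r w ≤ cw r v → u ∈ˢ Q →
                   cw r w ≤ cw r u × cw r u ≤ cw r v
  NextIn⇒between r vw rw≤rv uQ = arc⇒between r rw≤rv (NextIn⇒arc vw uQ)

-- Tiles

module _ {n : ℕ} {T : Tiling n} where

  InT-sym : ∀ {a b : Fin n} → InT T a b → InT T b a
  InT-sym (inj₁ ab) = inj₂ ab
  InT-sym (inj₂ ba) = inj₁ ba

  InT-noncrossing : ∀ {a b c d : Fin n} → IsTiling T → InT T a b → InT T c d →
                    StrictBetween a c b → StrictBetween b d a → ⊥
  InT-noncrossing {a} {b} {c} {d} (_ , noncrossing) ab cd acb bda = go ab cd
    where
    a≢c : a ≢ c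
    a≢c e = <⇒≢ (proj₁ acb) (sym (trans (cong (cw a) (sym e)) (cw-refl a)))
    c≢b : c ≢ b
    c≢b e = <⇒≢ (proj₂ acb) (cong (cw a) e)
    b≢d : b ≢ d
    b≢d e = <⇒≢ (proj₁ bda) (sym (trans (cong (cw b) (sym e)) (cw-refl b)))
    d≢a : d ≢ a
    d≢a e = <⇒≢ (proj₂ bda) (cong (cw b) e)
    go : InT T a b → InT T c d → ⊥
    go (inj₁ ab) (inj₁ cd) = noncrossing _ _ ab cd (a≢c , ≢-sym d≢a , ≢-sym c≢b , b≢d , inj₁ (acb , bda))
    go (inj₁ ab) (inj₂ dc) = noncrossing _ _ ab dc (≢-sym d≢a , a≢c , b≢d , ≢-sym c≢b , inj₂ (acb , bda))
    go (inj₂ ba) (inj₁ cd) = noncrossing _ _ ba cd (≢-sym c≢b , b≢d , a≢c , ≢-sym d≢a , inj₂ (bda , acb))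
    go (inj₂ ba) (inj₂ dc) = noncrossing _ _ ba dc (b≢d , ≢-sym c≢b , ≢-sym d≢a , a≢c , inj₁ (bda , acb))

  tile-third : ∀ {P : Subset n} → IsTile T P → (c d : Fin n) → Σ (Fin n) λ t → t ∈ˢ P × t ≢ c × t ≢ d
  tile-third {P} (3≤∣P∣ , _) = 3≤∣p∣⇒∃-third P 3≤∣P∣

  tile-side : ∀ {P : Subset n} {a b : Fin n} → IsTile T P → NextIn P a b → cw a b ≢ 1 → InT T a b
  tile-side (_ , sides , _) ab ab≢1 with sides _ _ ab
  ... | inj₁ ab≡1 = ⊥-elim (ab≢1 ab≡1)
  ... | inj₂ ab∈T = ab∈T

  NextIn-asym : ∀ {P : Subset n} {a b : Fin n} → IsTile T P → NextIn P a b → NextIn P b a → ⊥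
  NextIn-asym {P} {a} {b} tP (_ , _ , a≢b , after-a) (_ , _ , _ , after-b) with tile-third tP a b
  ... | t , tP' , t≢a , t≢b with after-a t tP' | after-b t tP'
  ...   | inj₁ e | _ = t≢a (sym (cw≡0⇒≡ e))
  ...   | inj₂ _ | inj₁ e = t≢b (sym (cw≡0⇒≡ e))
  ...   | inj₂ ab≤at | inj₂ ba≤bt = <⇒≱ (cw<n a t) (≤-trans (≤-reflexive (sym round))
            (subst (cw b a + cw a b ≤_) (cw-trans a b t ab≤at) (+-monoˡ-≤ (cw a b) ba≤bt)))
    where
    round : cw b a + cw a b ≡ n
    round = trans (+-comm (cw b a) (cw a b)) (cw+cw≡n a≢b)

  predecessors-ordered : ∀ {P : Subset n} {v w p pp : Fin n} (r : Fin n) → IsTile T P →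
    NextIn P v w → cw r w ≤ cw r v → NextIn P p v → NextIn P pp p →
    (cw r w ≤ cw r pp) × (cw r pp < cw r p) × (cw r p < cw r v)
  predecessors-ordered {P} {v} {w} {p} {pp} r tP vw rw≤rv pv ppp =
    proj₁ (NextIn⇒between r vw rw≤rv (source∈ ppp)) , rpp<rp , rp<rv
    where
    rp<rv : cw r p < cw r v
    rp<rv = ≤∧≢⇒< (proj₂ (NextIn⇒between r vw rw≤rv (source∈ pv))) (λ e → source≢target pv (cw-injective r e))
    rpp<rp : cw r pp < cw r p
    rpp<rp = NextIn⇒< r ppp (target∈ pv) (≤∧≢⇒< (proj₂ (NextIn⇒between r vw rw≤rv (source∈ ppp))) rpp≢rv)
      where
      rpp≢rv : cw r pp ≢ cw r v
      rpp≢rv e = NextIn-asym tP pv (subst (λ x → NextIn P x p) (cw-injective r e) ppp)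

  private
    -- m is the last vertex of Q strictly inside the arc (c, d); its successor in Q lies beyond,
    -- and unless it is d itself the side m → d' would cross the diagonal c d.
    last-before-endpoint : ∀ {Q : Subset n} {c d u' m d' : Fin n} → IsTiling T → IsTile T Q → InT T c d →
      u' ∈ˢ Q → cw c d < cw c u' → d ≢ c →
      m ∈ˢ Q → 0 < cw c m → cw c m < cw c d →
      (∀ v → v ∈ˢ Q × 0 < cw c v × cw c v < cw c d → cw c v ≤ cw c m) →
      NextIn Q m d' → d ∈ˢ Q
    last-before-endpoint {Q} {c} {d} {u'} {m} {d'} tT tQ cd u'Q cd<cu' d≢c mQ 0<cm cm<cd last md'
      with NextIn⇒< c md' u'Q (<-trans cm<cd cd<cu') | <-cmp (cw c d') (cw c d)
    ... | cm<cd' | tri< cd'<cd _ _ = ⊥-elim (<⇒≱ cm<cd' (last d' (target∈ md' , ≤-<-trans z≤n cm<cd' , cd'<cd)))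
    ... | _      | tri≈ _ e _ = subst (_∈ˢ Q) (cw-injective c e) (target∈ md')
    ... | cm<cd' | tri> _ _ cd<cd' with proj₁ (proj₂ tQ) m d' md'
    ...   | inj₁ md'≡1 = ⊥-elim (<⇒≱ cd<cd'
            (subst (_≤ cw c d) (trans (cong (_+ cw c m) (sym md'≡1)) (cw-trans c m d' (<⇒≤ cm<cd'))) cm<cd))
    ...   | inj₂ md'∈T = ⊥-elim (InT-noncrossing tT cd md'∈T (0<cm , cm<cd) (cw<⇒StrictBetween d≢c cd<cd'))

  straddling⇒endpoint∈ : ∀ {Q : Subset n} {c d u u' : Fin n} → IsTiling T → IsTile T Q → InT T c d →
    u ∈ˢ Q → StrictBetween c u d → u' ∈ˢ Q → StrictBetween d u' c → d ∈ˢ Q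
  straddling⇒endpoint∈ {Q} {c} {d} {u} {u'} tT tQ cd uQ cud u'Q du'c = from-last-inside
    (argmax (λ t → (t ∈? Q) ×-dec ((0 <? cw c t) ×-dec (cw c t <? cw c d))) (cw c) (cw c d)
            (λ _ inside → <⇒≤ (proj₂ (proj₂ inside))) u (uQ , cud))
    where
    cd<cu' : cw c d < cw c u'
    cd<cu' = StrictBetween⇒cw< {a = c} {d} {u'} du'c
    d≢c : d ≢ c
    d≢c e = <⇒≱ (≤-<-trans z≤n (proj₂ cud)) (≤-reflexive (trans (cong (cw c) e) (cw-refl c)))
    from-last-inside : (Σ (Fin n) λ m → (m ∈ˢ Q × 0 < cw c m × cw c m < cw c d) ×
                         (∀ v → v ∈ˢ Q × 0 < cw c v × cw c v < cw c d → cw c v ≤ cw c m)) → d ∈ˢ Q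
    from-last-inside (m , (mQ , 0<cm , cm<cd) , last) =
      last-before-endpoint tT tQ cd u'Q cd<cu' d≢c mQ 0<cm cm<cd last
        (proj₂ (NextIn-exists Q mQ u'Q (λ e → <⇒≢ (<-trans cm<cd cd<cu') (cong (cw c) (sym e)))))

  tile-not-straddling : ∀ {Q : Subset n} {c d u u' : Fin n} → IsTiling T → IsTile T Q → InT T c d →
    u ∈ˢ Q → StrictBetween c u d → u' ∈ˢ Q → ¬ StrictBetween d u' c
  tile-not-straddling {Q} {c} {d} {u} {u'} tT tQ cd uQ cud u'Q du'c = not-a-side (proj₂ (proj₂ tQ) c d cQ dQ cd)
    where
    dQ = straddling⇒endpoint∈ tT tQ cd uQ cud u'Q du'c
    cQ = straddling⇒endpoint∈ tT tQ (InT-sym cd) u'Q du'c uQ cud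
    not-a-side : NextIn Q c d ⊎ NextIn Q d c → ⊥
    not-a-side (inj₁ c→d) = NextIn⇒¬StrictBetween c→d uQ cud
    not-a-side (inj₂ d→c) = NextIn⇒¬StrictBetween d→c u'Q du'c

  private
    closest-side : ∀ {P : Subset n} {u c d : Fin n} → ¬ (u ∈ˢ P) → c ∈ˢ P →
      (∀ v → v ∈ˢ P → cw c u ≤ cw v u) → NextIn P c d → StrictBetween c u d
    closest-side {P} {u} {c} {d} u∉P cP closest (_ , dP , c≢d , _) with ≤-total (cw c d) (cw c u)
    ... | inj₂ cu≤cd = ≢⇒0<cw (λ c≡u → u∉P (subst (_∈ˢ P) c≡u cP)) ,
                       ≤∧≢⇒< cu≤cd (λ e → u∉P (subst (_∈ˢ P) (cw-injective c (sym e)) dP))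
    ... | inj₁ cd≤cu = ⊥-elim (<⇒≱ du<cu (closest d dP))
      where
      du<cu : cw d u < cw c u
      du<cu = subst (cw d u <_) (cw-trans c d u cd≤cu) (m<m+n (cw d u) (≢⇒0<cw c≢d))

  vertex-behind-side : ∀ {P : Subset n} {u : Fin n} → IsTile T P → ¬ (u ∈ˢ P) →
    Σ (Fin n) λ c → Σ (Fin n) λ d → NextIn P c d × StrictBetween c u d
  vertex-behind-side {P} {u} tP u∉P with tile-third tP u u
  ... | t₀ , t₀P , _ with argmin (_∈? P) (λ v → cw v u) t₀ t₀P
  ...   | c , cP , closest with tile-third tP c c
  ...     | t₁ , t₁P , t₁≢c , _ with NextIn-exists P cP t₁P t₁≢c
  ...       | d , c→d = c , d , c→d , closest-side u∉P cP closest c→d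

  side-with-vertex-behind∈T : ∀ {P : Subset n} {c d u : Fin n} → IsTile T P → NextIn P c d →
    StrictBetween c u d → InT T c d
  side-with-vertex-behind∈T tP c→d (0<cu , cu<cd) =
    tile-side tP c→d (λ cd≡1 → <⇒≱ (<-≤-trans 0<cu (s≤s⁻¹ (subst (_ <_) cd≡1 cu<cd))) ≤-refl)

  private
    tile-pocket-from-vertex : ∀ {P Q : Subset n} {u : Fin n} → IsTiling T → IsTile T P → IsTile T Q →
      u ∈ˢ Q → ¬ (u ∈ˢ P) → Σ (Fin n) λ c → Σ (Fin n) λ d → NextIn P c d × (∀ t → t ∈ˢ Q → cw c t ≤ cw c d)
    tile-pocket-from-vertex {P} {Q} {u} tT tP tQ uQ u∉P = pocket (vertex-behind-side tP u∉P)
      where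
      pocket : (Σ (Fin n) λ c → Σ (Fin n) λ d → NextIn P c d × StrictBetween c u d) →
               Σ (Fin n) λ c → Σ (Fin n) λ d → NextIn P c d × (∀ t → t ∈ˢ Q → cw c t ≤ cw c d)
      pocket (c , d , c→d , cud) = c , d , c→d , within
        where
        d≢c : d ≢ c
        d≢c e = <⇒≱ (≤-<-trans z≤n (proj₂ cud)) (≤-reflexive (trans (cong (cw c) e) (cw-refl c)))
        within : ∀ t → t ∈ˢ Q → cw c t ≤ cw c d
        within t tQ' = ≮⇒≥ λ cd<ct → tile-not-straddling {Q = Q} {c} {d} {u} {t} tT tQ
          (side-with-vertex-behind∈T {P = P} {c} {d} {u} tP c→d cud) uQ cud tQ'
          (cw<⇒StrictBetween {a = c} {d} {t} d≢c cd<ct)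

    tile-⊈-tile : ∀ {P Q : Subset n} {p : Fin n} → IsTile T P → IsTile T Q → Q ⊆ P → p ∈ˢ P → ¬ (p ∈ˢ Q) → ⊥
    tile-⊈-tile {P} {Q} {p} tP tQ Q⊆P pP p∉Q = behind (vertex-behind-side tQ p∉Q)
      where
      behind : (Σ (Fin n) λ c → Σ (Fin n) λ d → NextIn Q c d × StrictBetween c p d) → ⊥
      behind (c , d , c→d , cpd) = not-a-side (proj₂ (proj₂ tP) c d (Q⊆P (source∈ c→d)) (Q⊆P (target∈ c→d))
                                                 (side-with-vertex-behind∈T {P = Q} {c} {d} {p} tQ c→d cpd))
        where
        third-inside : (Σ (Fin n) λ t → t ∈ˢ Q × t ≢ c × t ≢ d) → NextIn P d c → ⊥
        third-inside (t , tQ' , t≢c , t≢d) d→c-in-P = NextIn⇒¬StrictBetween {Q = Q} {c} {d} {t} c→d tQ'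
          (≢⇒0<cw (≢-sym t≢c) ,
           ≤∧≢⇒< (NextIn⇒arc {Q = P} {d} {c} {t} d→c-in-P (Q⊆P tQ')) (λ e → t≢d (cw-injective c e)))
        not-a-side : NextIn P c d ⊎ NextIn P d c → ⊥
        not-a-side (inj₁ c→d-in-P) = NextIn⇒¬StrictBetween {Q = P} {c} {d} {p} c→d-in-P pP cpd
        not-a-side (inj₂ d→c-in-P) = third-inside (tile-third tQ c d) d→c-in-P

    ¬∃∖⇒⊆ : ∀ {A B : Subset n} → ¬ (Σ (Fin n) λ t → t ∈ˢ B × ¬ (t ∈ˢ A)) → B ⊆ A
    ¬∃∖⇒⊆ {A} none {t} tB with t ∈? A
    ... | yes tA = tA
    ... | no t∉A = ⊥-elim (none (t , tB , t∉A))

  tile-in-pocket : ∀ {P Q : Subset n} → IsTiling T → IsTile T P → IsTile T Q → P ≢ Q →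
    Σ (Fin n) λ c → Σ (Fin n) λ d → NextIn P c d × (∀ t → t ∈ˢ Q → cw c t ≤ cw c d)
  tile-in-pocket {P} {Q} tT tP tQ P≢Q with Fin.any? (λ t → (t ∈? Q) ×-dec ¬? (t ∈? P))
  ... | yes (u , uQ , u∉P) = tile-pocket-from-vertex tT tP tQ uQ u∉P
  ... | no Q⊆P with Fin.any? (λ t → (t ∈? P) ×-dec ¬? (t ∈? Q))
  ...   | yes (p , pP , p∉Q) = ⊥-elim (tile-⊈-tile tP tQ (¬∃∖⇒⊆ Q⊆P) pP p∉Q)
  ...   | no P⊆Q = ⊥-elim (P≢Q (⊆-antisym (¬∃∖⇒⊆ P⊆Q) (¬∃∖⇒⊆ Q⊆P)))

-- Existence of tiles

InT⇒IsDiagonal : ∀ {n} {T : Tiling n} {c d : Fin n} → IsTiling T → InT T c d → IsDiagonal c d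
InT⇒IsDiagonal (diagonals , _) (inj₁ cd) = All.lookup diagonals cd
InT⇒IsDiagonal (diagonals , _) (inj₂ dc) with All.lookup diagonals dc
... | d≢c , dc≢1 , cd≢1 = ≢-sym d≢c , cd≢1 , dc≢1

IsDiagonal⇒2≤cw : ∀ {n} {c d : Fin n} → IsDiagonal c d → 2 ≤ cw c d
IsDiagonal⇒2≤cw {c = c} {d} (c≢d , cd≢1 , _) with cw c d in eq
... | zero = ⊥-elim (c≢d (cw≡0⇒≡ eq))
... | suc zero = ⊥-elim (cd≢1 refl)
... | suc (suc _) = s≤s (s≤s z≤n)

-- The tile with side a → b is cut out of the arc from b to a: its vertices are those of the arc
-- that no diagonal of T between two vertices of the arc (other than b a itself) separates from a b.
module TileBehind {n : ℕ} (T : Tiling n) (tT : IsTiling T) (a b : Fin n)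
                  (ab-side : BdryCW a b ⊎ InT T a b) (2≤ba : 2 ≤ cw b a) where

  private
    open import Data.List.Membership.DecPropositional (Product.≡-dec (Fin._≟_ {n}) (Fin._≟_ {n}))
      using () renaming (_∈?_ to _∈ˡ?_)

    ℓ : ℕ
    ℓ = cw b a

    InT? : ∀ c d → Dec (InT T c d)
    InT? c d = ((c , d) ∈ˡ? T) ⊎-dec ((d , c) ∈ˡ? T)

  DiagonalIn : Fin n → Fin n → Set
  DiagonalIn c d = InT T c d × cw b c < cw b d × cw b d ≤ ℓ × ¬ (cw b c ≡ 0 × cw b d ≡ ℓ)

  DiagonalIn? : ∀ c d → Dec (DiagonalIn c d)
  DiagonalIn? c d = InT? c d ×-dec ((cw b c <? cw b d) ×-dec ((cw b d ≤? ℓ) ×-dec ¬? ((cw b c ≟ 0) ×-dec (cw b d ≟ ℓ))))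

  Hidden : Fin n → Set
  Hidden u = Σ (Fin n) λ c → Σ (Fin n) λ d → DiagonalIn c d × cw b c < cw b u × cw b u < cw b d

  Hidden? : ∀ u → Dec (Hidden u)
  Hidden? u = Fin.any? λ c → Fin.any? λ d → DiagonalIn? c d ×-dec ((cw b c <? cw b u) ×-dec (cw b u <? cw b d))

  Visible : Fin n → Set
  Visible u = cw b u ≤ ℓ × ¬ Hidden u

  Visible? : ∀ u → Dec (Visible u)
  Visible? u = (cw b u ≤? ℓ) ×-dec ¬? (Hidden? u)

  tile : Subset n
  tile = tabulate (λ u → does (Visible? u))

  ∈tile⇒Visible : ∀ {u : Fin n} → u ∈ˢ tile → Visible u
  ∈tile⇒Visible {u} u∈ = toWitness {a? = Visible? u} (subst Bool.T (sym (begin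
    isYes (Visible? u)          ≡⟨ isYes≗does (Visible? u) ⟩
    does (Visible? u)           ≡⟨ Vec.lookup∘tabulate (λ u → does (Visible? u)) u ⟨
    lookup tile u               ≡⟨ Vec.[]=⇒lookup u∈ ⟩
    true                        ∎)) tt)

  Visible⇒∈tile : ∀ {u : Fin n} → Visible u → u ∈ˢ tile
  Visible⇒∈tile {u} vis =
    Vec.lookup⇒[]= u tile (trans (Vec.lookup∘tabulate (λ u → does (Visible? u)) u) (dec-true (Visible? u) vis))

  private
    cw-b-b : cw b b ≡ 0
    cw-b-b = cw-refl b

    a≢b : a ≢ b
    a≢b e = <⇒≱ (<-≤-trans (s≤s z≤n) 2≤ba) (≤-reflexive (trans (cong (cw b) e) cw-b-b))

    b-visible : Visible b
    b-visible = subst (_≤ ℓ) (sym cw-b-b) z≤n ,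
                λ { (c , d , _ , bc<bb , _) → <⇒≱ bc<bb (subst (_≤ cw b c) (sym cw-b-b) z≤n) }

    a-visible : Visible a
    a-visible = ≤-refl , λ { (c , d , (_ , _ , bd≤ℓ , _) , _ , ba<bd) → <⇒≱ ba<bd bd≤ℓ }

  a→b : NextIn tile a b
  a→b = Visible⇒∈tile a-visible , Visible⇒∈tile b-visible , a≢b , after
    where
    after : ∀ t → t ∈ˢ tile → (cw a t ≡ 0) ⊎ (cw a b ≤ cw a t)
    after t t∈ with t Fin.≟ a
    ... | yes refl = inj₁ (cw-refl a)
    ... | no t≢a = inj₂ (+-cancelʳ-≤ ℓ (cw a b) (cw a t) (subst₂ _≤_ (sym ab) (sym at) (m≤n+m n (cw b t))))
      where
      ab : cw a b + ℓ ≡ 0 + n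
      ab = trans (cw-trans-wrap b a b (subst (_< ℓ) (sym cw-b-b) (<-≤-trans (s≤s z≤n) 2≤ba))) (cong (_+ n) cw-b-b)
      at : cw a t + ℓ ≡ cw b t + n
      at = cw-trans-wrap b a t (≤∧≢⇒< (proj₁ (∈tile⇒Visible t∈)) (λ e → t≢a (cw-injective b e)))

  private
    -- A diagonal hiding d would hide c, or reach from c beyond d, or cross c d.
    farthest-diagonal : ∀ {c d₀ : Fin n} → Visible c → DiagonalIn c d₀ →
                        Σ (Fin n) λ d → DiagonalIn c d × Visible d
    farthest-diagonal {c} {d₀} c-vis cd₀
      with argmax (DiagonalIn? c) (cw b) ℓ (λ _ cv → proj₁ (proj₂ (proj₂ cv))) d₀ cd₀
    ... | d , cd@(c-d , bc<bd , bd≤ℓ , not-ba) , farthest = d , cd , bd≤ℓ , d-not-hidden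
      where
      d-not-hidden : ¬ Hidden d
      d-not-hidden (c' , d' , c'd'@(c'-d' , _ , bd'≤ℓ , not-ba') , bc'<bd , bd<bd') with <-cmp (cw b c') (cw b c)
      ... | tri< bc'<bc _ _ = proj₂ c-vis (c' , d' , c'd' , bc'<bc , <-trans bc<bd bd<bd')
      ... | tri≈ _ e _ = <⇒≱ bd<bd' (farthest d'
            (subst (λ x → InT T x d') c'≡c c'-d' , subst (_< cw b d') e (<-trans bc'<bd bd<bd') , bd'≤ℓ ,
             λ (bc≡0 , bd'≡ℓ) → not-ba' (trans e bc≡0 , bd'≡ℓ)))
        where c'≡c = cw-injective b e
      ... | tri> _ _ bc<bc' = InT-noncrossing tT c-d c'-d'
            (<<⇒StrictBetween b bc<bc' bc'<bd) (<<⇒StrictBetween-wrap b bc<bd bd<bd')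

    third-visible : Σ (Fin n) λ t → Visible t × t ≢ a × t ≢ b
    third-visible with cw-surjective b 1 (<-≤-trans (s≤s (s≤s z≤n)) (≤-trans 2≤ba (<⇒≤ (cw<n b a))))
    ... | m , bm≡1 with Visible? m
    ...   | yes m-vis = m , m-vis , (λ m≡a → <⇒≱ 2≤ba (≤-reflexive (trans (sym (cong (cw b) m≡a)) bm≡1))) ,
                        (λ m≡b → 1+n≰n (≤-reflexive (trans (sym bm≡1) (trans (cong (cw b) m≡b) cw-b-b))))
    ...   | no m-invis with Hidden? m
    ...     | no m-unhidden = ⊥-elim (m-invis (subst (_≤ ℓ) (sym bm≡1) (<-≤-trans (s≤s z≤n) 2≤ba) , m-unhidden))
    ...     | yes (c , d , (c-d , _ , bd≤ℓ , not-ba) , bc<bm , bm<bd) with farthest-diagonal b-visible bd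
      where
      bc≡0 : cw b c ≡ 0
      bc≡0 = n≤0⇒n≡0 (s≤s⁻¹ (subst (cw b c <_) bm≡1 bc<bm))
      c≡b : c ≡ b
      c≡b = cw-injective b (trans bc≡0 (sym cw-b-b))
      bd : DiagonalIn b d
      bd = subst (λ x → InT T x d) c≡b c-d ,
           subst (_< cw b d) (sym cw-b-b) (<-trans (subst (0 <_) (sym bm≡1) (s≤s z≤n)) bm<bd) , bd≤ℓ ,
           λ (_ , bd≡ℓ) → not-ba (bc≡0 , bd≡ℓ)
    ...       | d* , (_ , bb<bd* , _ , not-ba*) , d*-vis =
      d* , d*-vis , (λ d*≡a → not-ba* (cw-b-b , cong (cw b) d*≡a)) ,
      (λ d*≡b → <⇒≢ bb<bd* (cong (cw b) (sym d*≡b)))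

  3≤∣tile∣ : 3 ≤ ∣ tile ∣
  3≤∣tile∣ with third-visible
  ... | t , t-vis , t≢a , t≢b =
    3≤∣p∣ (Visible⇒∈tile a-visible) (Visible⇒∈tile b-visible) (Visible⇒∈tile t-vis)
          a≢b (≢-sym t≢a) (≢-sym t≢b)

  private
    module Side {a' b' : Fin n} (a'→b' : NextIn tile a' b') (a'≢a : a' ≢ a) where
      a'-vis : Visible a'
      a'-vis = ∈tile⇒Visible (source∈ a'→b')
      b'-vis : Visible b'
      b'-vis = ∈tile⇒Visible (target∈ a'→b')

      ba'<bb' : cw b a' < cw b b'
      ba'<bb' = NextIn⇒< b a'→b' (Visible⇒∈tile a-visible) (≤∧≢⇒< (proj₁ a'-vis) (λ e → a'≢a (cw-injective b e)))

      -- The vertex right after a' is hidden only by a diagonal starting at a'; the farthest one ends at b'.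
      hidden-successor⇒diagonal : ∀ {m : Fin n} → cw b m ≡ suc (cw b a') → Hidden m → InT T a' b'
      hidden-successor⇒diagonal {m} bm≡1+ba' (c , d , (c-d , _ , bd≤ℓ , not-ba) , bc<bm , bm<bd)
        with farthest-diagonal a'-vis a'd
        where
        ba'<bm : cw b a' < cw b m
        ba'<bm = subst (cw b a' <_) (sym bm≡1+ba') ≤-refl
        bc≡ba' : cw b c ≡ cw b a'
        bc≡ba' with <-cmp (cw b c) (cw b a')
        ... | tri≈ _ e _ = e
        ... | tri> _ _ ba'<bc = ⊥-elim (<⇒≱ ba'<bc (s≤s⁻¹ (subst (cw b c <_) bm≡1+ba' bc<bm)))
        ... | tri< bc<ba' _ _ = ⊥-elim (proj₂ a'-vis (c , d , (c-d , <-trans bc<ba' (<-trans ba'<bm bm<bd) , bd≤ℓ , not-ba) ,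
                                                      bc<ba' , <-trans ba'<bm bm<bd))
        a'd : DiagonalIn a' d
        a'd = subst (λ x → InT T x d) (cw-injective b bc≡ba') c-d , <-trans ba'<bm bm<bd , bd≤ℓ ,
              λ (ba'≡0 , bd≡ℓ) → not-ba (trans bc≡ba' ba'≡0 , bd≡ℓ)
      ... | d* , a'd*@(a'-d* , ba'<bd* , _ , _) , d*-vis with <-cmp (cw b d*) (cw b b')
      ...   | tri≈ _ e _ = subst (InT T a') (cw-injective b e) a'-d*
      ...   | tri< bd*<bb' _ _ = ⊥-elim (<⇒≱ bd*<bb' (NextIn⇒≤ b a'→b' ba'<bb' (Visible⇒∈tile d*-vis) ba'<bd*))
      ...   | tri> _ _ bb'<bd* = ⊥-elim (proj₂ b'-vis (a' , d* , a'd* , ba'<bb' , bb'<bd*))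

      side : BdryCW a' b' ⊎ InT T a' b'
      side with cw b b' ≟ suc (cw b a')
      ... | yes e = inj₁ (+-cancelʳ-≡ (cw b a') (cw a' b') 1 (trans (cw-trans b a' b' (<⇒≤ ba'<bb')) e))
      ... | no ≢1+ba' with cw-surjective b (suc (cw b a')) (<-trans 1+ba'<bb' (cw<n b b'))
        where 1+ba'<bb' = ≤∧≢⇒< ba'<bb' (≢-sym ≢1+ba')
      ...   | m , bm≡1+ba' with Visible? m
      ...     | yes m-vis = ⊥-elim (<⇒≱ (subst (_< cw b b') (sym bm≡1+ba') (≤∧≢⇒< ba'<bb' (≢-sym ≢1+ba')))
                (NextIn⇒≤ b a'→b' ba'<bb' (Visible⇒∈tile m-vis) (subst (cw b a' <_) (sym bm≡1+ba') ≤-refl)))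
      ...     | no m-invis with Hidden? m
      ...       | yes m-hidden = inj₂ (hidden-successor⇒diagonal bm≡1+ba' m-hidden)
      ...       | no m-unhidden = ⊥-elim (m-invis (≤-trans (≤-reflexive bm≡1+ba')
                  (≤-trans ba'<bb' (proj₁ b'-vis)) , m-unhidden))

    sides : ∀ a' b' → NextIn tile a' b' → BdryCW a' b' ⊎ InT T a' b'
    sides a' b' a'→b' with a' Fin.≟ a
    ... | no a'≢a = Side.side a'→b' a'≢a
    ... | yes refl with NextIn-functional a→b a'→b'
    ...   | refl = ab-side

    diagonal⇒side-< : ∀ a' b' → cw b a' < cw b b' → a' ∈ˢ tile → b' ∈ˢ tile → InT T a' b' →
                      NextIn tile a' b' ⊎ NextIn tile b' a'
    diagonal⇒side-< a' b' ba'<bb' a'∈ b'∈ a'-b' with (cw b a' ≟ 0) ×-dec (cw b b' ≟ ℓ)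
    ... | yes (ba'≡0 , bb'≡ℓ) =
      inj₂ (subst₂ (NextIn tile) (sym (cw-injective b bb'≡ℓ)) (cw-injective b (trans cw-b-b (sym ba'≡0))) a→b)
    ... | no not-ba = inj₁ (≤⇒NextIn b a'∈ b'∈ ba'<bb' λ t t∈ ba'<bt → ≮⇒≥ λ bt<bb' →
      proj₂ (∈tile⇒Visible t∈) (a' , b' , (a'-b' , ba'<bb' , proj₁ (∈tile⇒Visible b'∈) , not-ba) , ba'<bt , bt<bb'))

    diagonal⇒side : ∀ a' b' → a' ∈ˢ tile → b' ∈ˢ tile → InT T a' b' → NextIn tile a' b' ⊎ NextIn tile b' a'
    diagonal⇒side a' b' a'∈ b'∈ a'-b' with <-cmp (cw b a') (cw b b')
    ... | tri< lt _ _ = diagonal⇒side-< a' b' lt a'∈ b'∈ a'-b'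
    ... | tri≈ _ e _ = ⊥-elim (proj₁ (InT⇒IsDiagonal tT a'-b') (cw-injective b e))
    ... | tri> _ _ gt = swap (diagonal⇒side-< b' a' gt b'∈ a'∈ (InT-sym a'-b'))

  isTile : IsTile T tile
  isTile = 3≤∣tile∣ , sides , diagonal⇒side

tile-behind : ∀ {n} {T : Tiling n} → IsTiling T → (a b : Fin n) → BdryCW a b ⊎ InT T a b → 2 ≤ cw b a →
              Σ (Subset n) λ Q → IsTile T Q × NextIn Q a b
tile-behind {T = T} tT a b ab-side 2≤ba = tile , isTile , a→b
  where open TileBehind T tT a b ab-side 2≤ba

-- Strands

module _ {n : ℕ} {T : Tiling n} where

  Path-end-between : ∀ {P : Subset n} {v y w : Fin n} (r : Fin n) → Path T P v y → IsTile T P →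
    NextIn P v w → cw r w ≤ cw r v → cw r w < cw r y × cw r y < cw r v
  Path-end-between r (stop pv ppp _) tP vw rw≤rv with predecessors-ordered r tP vw rw≤rv pv ppp
  ... | rw≤rpp , rpp<rp , rp<rv = ≤-<-trans rw≤rpp rpp<rp , rp<rv
  Path-end-between r (step pv ppp _ tP' p→pp rest) tP vw rw≤rv with predecessors-ordered r tP vw rw≤rv pv ppp
  ... | rw≤rpp , rpp<rp , rp<rv with Path-end-between r rest tP' p→pp (<⇒≤ rpp<rp)
  ...   | rpp<ry , ry<rp = ≤-<-trans rw≤rpp rpp<ry , <-trans ry<rp rp<rv

  -- Q sits behind some side c → d of P (tile-in-pocket); the vertices u₁ and u₂ force that side to be pp → p.
  tile-behind-predecessor-side : ∀ {P Q : Subset n} {v w p pp u₁ u₂ : Fin n} (r : Fin n) →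
    IsTiling T → IsTile T P → IsTile T Q → P ≢ Q →
    NextIn P v w → cw r w ≤ cw r v → NextIn P p v → NextIn P pp p →
    (∀ t → t ∈ˢ Q → cw r w ≤ cw r t × cw r t ≤ cw r v) →
    u₁ ∈ˢ Q → cw r u₁ < cw r p → u₂ ∈ˢ Q → cw r pp < cw r u₂ →
    ∀ t → t ∈ˢ Q → cw r pp ≤ cw r t × cw r t ≤ cw r p
  tile-behind-predecessor-side {P} {Q} {v} {w} {p} {pp} {u₁} {u₂} r tT tP tQ P≢Q vw rw≤rv pv ppp Q-between
    u₁Q ru₁<rp u₂Q rpp<ru₂ with tile-in-pocket tT tP tQ P≢Q
  ... | c , d , cd , Q-behind = subst₂ (λ x y → ∀ t → t ∈ˢ Q → cw r x ≤ cw r t × cw r t ≤ cw r y) c≡pp d≡p Q-cd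
    where
    c≢v : c ≢ v
    c≢v refl with NextIn-functional cd vw
    ... | refl with tile-third tQ v w
    ...   | t , tQ' , t≢v , t≢w = <⇒≱ (+-cancelʳ-< (cw r v) (cw v w) (cw v t)
              (subst₂ _<_ (sym (cw-trans-wrap r v w rw<rv)) (sym (cw-trans-wrap r v t rt<rv)) (+-monoˡ-< n rw<rt)))
              (Q-behind t tQ')
      where
      rw<rt : cw r w < cw r t
      rw<rt = ≤∧≢⇒< (proj₁ (Q-between t tQ')) (λ e → t≢w (cw-injective r (sym e)))
      rt<rv : cw r t < cw r v
      rt<rv = ≤∧≢⇒< (proj₂ (Q-between t tQ')) (λ e → t≢v (cw-injective r e))
      rw<rv = <-trans rw<rt rt<rv
    rc<rv : cw r c < cw r v
    rc<rv = ≤∧≢⇒< (proj₂ (NextIn⇒between r vw rw≤rv (source∈ cd))) (λ e → c≢v (cw-injective r e))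
    rc<rd : cw r c < cw r d
    rc<rd = NextIn⇒< r cd (source∈ vw) rc<rv
    Q-cd : ∀ t → t ∈ˢ Q → cw r c ≤ cw r t × cw r t ≤ cw r d
    Q-cd t tQ' = arc⇒between r (<⇒≤ rc<rd) (Q-behind t tQ')
    rc<rp : cw r c < cw r p
    rc<rp = ≤-<-trans (proj₁ (Q-cd u₁ u₁Q)) ru₁<rp
    rpp<rd : cw r pp < cw r d
    rpp<rd = <-≤-trans rpp<ru₂ (proj₂ (Q-cd u₂ u₂Q))
    d≡p : d ≡ p
    d≡p with <-cmp (cw r d) (cw r p)
    ... | tri≈ _ e _ = cw-injective r e
    ... | tri> _ _ rp<rd = ⊥-elim (<⇒≱ rp<rd (NextIn⇒≤ r cd rc<rd (target∈ ppp) rc<rp))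
    ... | tri< rd<rp _ _ = ⊥-elim (<⇒≱ rd<rp (NextIn⇒≤ r ppp (<-trans rpp<rd rd<rp) (target∈ cd) rpp<rd))
    c≡pp : c ≡ pp
    c≡pp = NextIn-injective (subst (NextIn P c) d≡p cd) ppp

  Path-uses-straddling-tile : ∀ {P Q : Subset n} {v y w u₁ u₂ : Fin n} (r : Fin n) → IsTiling T → IsTile T Q →
    (path : Path T P v y) → IsTile T P → NextIn P v w → cw r w ≤ cw r v →
    (∀ t → t ∈ˢ Q → cw r w ≤ cw r t × cw r t ≤ cw r v) →
    u₁ ∈ˢ Q → cw r u₁ < cw r y → u₂ ∈ˢ Q → cw r y ≤ cw r u₂ → UsesP path Q
  Path-uses-straddling-tile {P} {Q} r tT tQ path tP vw rw≤rv Q-between u₁Q ru₁<ry u₂Q ry≤ru₂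
    with Vec.≡-dec Bool._≟_ P Q
  Path-uses-straddling-tile r tT tQ (stop _ _ _) tP vw rw≤rv Q-between u₁Q ru₁<ry u₂Q ry≤ru₂ | yes P≡Q = P≡Q
  Path-uses-straddling-tile r tT tQ (step _ _ _ _ _ _) tP vw rw≤rv Q-between u₁Q ru₁<ry u₂Q ry≤ru₂ | yes P≡Q = inj₁ P≡Q
  Path-uses-straddling-tile r tT tQ (stop {p = p} {pp = pp} pv ppp pp→p-boundary) tP vw rw≤rv Q-between
    u₁Q ru₁<ry u₂Q ry≤ru₂ | no P≢Q with predecessors-ordered r tP vw rw≤rv pv ppp
  ... | _ , rpp<rp , _ with tile-third tQ pp p
  ...   | t , tQ' , t≢pp , t≢p = ⊥-elim (<⇒≱ rt<rp
          (subst (_≤ cw r t) (trans (cong (_+ cw r pp) (sym pp→p-boundary)) (cw-trans r pp p (<⇒≤ rpp<rp))) rpp<rt))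
    where
    Q-in-pocket = tile-behind-predecessor-side r tT tP tQ P≢Q vw rw≤rv pv ppp Q-between u₁Q ru₁<ry u₂Q
                    (<-≤-trans rpp<rp ry≤ru₂)
    rpp<rt : cw r pp < cw r t
    rpp<rt = ≤∧≢⇒< (proj₁ (Q-in-pocket t tQ')) (λ e → t≢pp (cw-injective r (sym e)))
    rt<rp : cw r t < cw r p
    rt<rp = ≤∧≢⇒< (proj₂ (Q-in-pocket t tQ')) (λ e → t≢p (cw-injective r e))
  Path-uses-straddling-tile r tT tQ (step pv ppp _ tP' p→pp rest) tP vw rw≤rv Q-between
    u₁Q ru₁<ry u₂Q ry≤ru₂ | no P≢Q with predecessors-ordered r tP vw rw≤rv pv ppp
  ... | _ , rpp<rp , _ with Path-end-between r rest tP' p→pp (<⇒≤ rpp<rp)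
  ...   | rpp<ry , ry<rp = inj₂ (Path-uses-straddling-tile r tT tQ rest tP' p→pp (<⇒≤ rpp<rp)
          (tile-behind-predecessor-side r tT tP tQ P≢Q vw rw≤rv pv ppp Q-between u₁Q (<-trans ru₁<ry ry<rp) u₂Q
            (<-≤-trans rpp<ry ry≤ru₂))
          u₁Q ru₁<ry u₂Q ry≤ru₂)

module _ {n : ℕ} where

  cw-from-successor : ∀ (y y⁺ : Fin n) {t : Fin n} → BdryCW y y⁺ → t ≢ y → cw y⁺ t + 1 ≡ cw y t
  cw-from-successor y y⁺ {t} yy⁺≡1 t≢y =
    subst (λ k → cw y⁺ t + k ≡ cw y t) yy⁺≡1 (cw-trans y y⁺ t (subst (_≤ cw y t) (sym yy⁺≡1) (≢⇒0<cw (≢-sym t≢y))))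

  cw-from-successor-≤ : ∀ (y y⁺ : Fin n) → BdryCW y y⁺ → ∀ t → cw y⁺ t ≤ cw y⁺ y
  cw-from-successor-≤ y y⁺ yy⁺≡1 t = +-cancelʳ-≤ 1 (cw y⁺ t) (cw y⁺ y)
    (subst₂ _≤_ (+-comm 1 (cw y⁺ t)) (sym y⁺y+1≡n) (cw<n y⁺ t))
    where
    y≢y⁺ : y ≢ y⁺
    y≢y⁺ e = 1+n≰n (≤-reflexive (trans (sym yy⁺≡1) (trans (cong (λ k → cw k y⁺) e) (cw-refl y⁺))))
    y⁺y+1≡n : cw y⁺ y + 1 ≡ n
    y⁺y+1≡n = trans (+-comm (cw y⁺ y) 1) (subst (λ k → k + cw y⁺ y ≡ n) yy⁺≡1 (cw+cw≡n y≢y⁺))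

  -- Measured from the successor y⁺ of y, the whole polygon is the arc [y⁺, y], and z separates q from u.
  Strand-crosses-tile : ∀ {T : Tiling n} {Q : Subset n} {y z q u : Fin n} → IsTiling T → IsTile T Q →
    (σ : Strand T y z) → q ∈ˢ Q → StrictBetween y q z → u ∈ˢ Q → ¬ StrictBetween y u z → LongFor σ Q
  Strand-crosses-tile {Q = Q} {y} {z} {q} {u} tT tQ (strand P tP y⁺ y→y⁺ yy⁺≡1 path) qQ (0<yq , yq<yz) uQ u-outside =
    Path-uses-straddling-tile y⁺ tT tQ path tP y→y⁺ (subst (_≤ cw y⁺ y) (sym (cw-refl y⁺)) z≤n)
      (λ t _ → subst (_≤ cw y⁺ t) (sym (cw-refl y⁺)) z≤n , cw-from-successor-≤ y y⁺ yy⁺≡1 t)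
      qQ y⁺q<y⁺z uQ y⁺z≤y⁺u
    where
    q≢y : q ≢ y
    q≢y e = <⇒≢ 0<yq (sym (trans (cong (cw y) e) (cw-refl y)))
    z≢y : z ≢ y
    z≢y e = <⇒≢ (<-trans 0<yq yq<yz) (sym (trans (cong (cw y) e) (cw-refl y)))
    y⁺q<y⁺z : cw y⁺ q < cw y⁺ z
    y⁺q<y⁺z = +-cancelʳ-< 1 (cw y⁺ q) (cw y⁺ z)
      (subst₂ _<_ (sym (cw-from-successor y y⁺ yy⁺≡1 q≢y)) (sym (cw-from-successor y y⁺ yy⁺≡1 z≢y)) yq<yz)
    y⁺z≤y⁺u : cw y⁺ z ≤ cw y⁺ u
    y⁺z≤y⁺u with u Fin.≟ y
    ... | yes refl = cw-from-successor-≤ y y⁺ yy⁺≡1 z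
    ... | no u≢y = +-cancelʳ-≤ 1 (cw y⁺ z) (cw y⁺ u)
      (subst₂ _≤_ (sym (cw-from-successor y y⁺ yy⁺≡1 z≢y)) (sym (cw-from-successor y y⁺ yy⁺≡1 u≢y))
        (≮⇒≥ λ yu<yz → u-outside (≢⇒0<cw (≢-sym u≢y) , yu<yz)))

  InOC⇒between : ∀ {s₁ q s₂ z : Fin n} → cw s₁ q ≤ cw s₁ s₂ → InOC q s₂ z →
                 cw s₁ q < cw s₁ z × cw s₁ z ≤ cw s₁ s₂
  InOC⇒between {s₁} {q} {s₂} {z} s₁q≤s₁s₂ (0<qz , qz≤qs₂) with cw-triangle s₁ q z
  ... | inj₁ e = subst (cw s₁ q <_) e (+-monoˡ-< (cw s₁ q) 0<qz) ,
                 subst₂ _≤_ e (cw-trans s₁ q s₂ s₁q≤s₁s₂) (+-monoˡ-≤ (cw s₁ q) qz≤qs₂)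
  ... | inj₂ e = ⊥-elim (<⇒≱ (cw<n s₁ s₂) (≤-trans (m≤n+m n (cw s₁ z))
                   (subst₂ _≤_ e (cw-trans s₁ q s₂ s₁q≤s₁s₂) (+-monoˡ-≤ (cw s₁ q) qz≤qs₂))))

  MeetsInSegment⇒uncovered-vertex : ∀ {Q : Subset n} {s₁ q s₂ y z : Fin n} → StrictBetween s₁ q s₂ →
    InCO s₁ q y → InOC q s₂ z → MeetsInSegment Q s₁ s₂ → Σ (Fin n) λ u → u ∈ˢ Q × ¬ StrictBetween y u z
  MeetsInSegment⇒uncovered-vertex {Q} {s₁} {q} {s₂} {y} {z} (_ , s₁q<s₁s₂) s₁y<s₁q q<z≤s₂ = uncovered
    where
    z-range = InOC⇒between {s₁ = s₁} {q} {s₂} {z} (<⇒≤ s₁q<s₁s₂) q<z≤s₂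
    between : ∀ {u} → StrictBetween y u z → cw s₁ y ≤ cw s₁ u × cw s₁ u ≤ cw s₁ z
    between {u} yuz = arc⇒between s₁ {y} {z} {u} (<⇒≤ (<-trans s₁y<s₁q (proj₁ z-range))) (<⇒≤ (proj₂ yuz))
    uncovered : MeetsInSegment Q s₁ s₂ → Σ (Fin n) λ u → u ∈ˢ Q × ¬ StrictBetween y u z
    uncovered (inj₁ (s₁Q , _)) = s₁ , s₁Q , λ ys₁z →
      let s₁≡y = cw≡0⇒≡ {a = s₁} {y} (n≤0⇒n≡0 (subst (cw s₁ y ≤_) (cw-refl s₁) (proj₁ (between ys₁z))))
      in <⇒≢ (proj₁ ys₁z) (sym (trans (cong (λ x → cw x s₁) (sym s₁≡y)) (cw-refl s₁)))
    uncovered (inj₂ (_ , w , _ , wQ , _ , s₂ws₁)) = w , wQ , λ ywz →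
      <⇒≱ (StrictBetween⇒cw< {a = s₁} {s₂} {w} s₂ws₁) (≤-trans (proj₂ (between ywz)) (proj₂ z-range))

  CoveringStrand : Tiling n → Fin n → Fin n → Fin n → Set
  CoveringStrand T s₁ s₂ q = Σ (Fin n) λ y → Σ (Fin n) λ z →
    Strand T y z × cw s₁ y < cw s₁ q × cw s₁ q < cw s₁ z × cw s₁ z ≤ cw s₁ s₂

  CoveringStrand-widen : ∀ {T : Tiling n} {s₁ s₂ c d q : Fin n} → cw s₁ c ≤ cw s₁ d → cw s₁ d ≤ cw s₁ s₂ →
    CoveringStrand T c d q → CoveringStrand T s₁ s₂ q
  CoveringStrand-widen {s₁ = s₁} {s₂} {c} {d} {q} s₁c≤s₁d s₁d≤s₁s₂ (y , z , σ , cy<cq , cq<cz , cz≤cd) =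
    y , z , σ , subst₂ _<_ (shift y cy≤cd) (shift q cq≤cd) (+-monoˡ-< (cw s₁ c) cy<cq) ,
    subst₂ _<_ (shift q cq≤cd) (shift z cz≤cd) (+-monoˡ-< (cw s₁ c) cq<cz) ,
    ≤-trans (subst₂ _≤_ (shift z cz≤cd) (shift d ≤-refl) (+-monoˡ-≤ (cw s₁ c) cz≤cd)) s₁d≤s₁s₂
    where
    cq≤cd = <⇒≤ (<-≤-trans cq<cz cz≤cd)
    cy≤cd = <⇒≤ (<-≤-trans cy<cq cq≤cd)
    shift : ∀ t → cw c t ≤ cw c d → cw c t + cw s₁ c ≡ cw s₁ t
    shift t ct≤cd = cw-trans s₁ c t (proj₁ (arc⇒between s₁ s₁c≤s₁d ct≤cd))

  CoveringStrand⇒covers : ∀ {T : Tiling n} {s₁ s₂ q : Fin n} → StrictBetween s₁ q s₂ → CoveringStrand T s₁ s₂ q →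
    Σ (Fin n) λ y → Σ (Fin n) λ z → Strand T y z × Covers y q z × InCO s₁ q y × InOC q s₂ z
  CoveringStrand⇒covers {s₁ = s₁} {s₂} {q} (_ , s₁q<s₁s₂) (y , z , σ , s₁y<s₁q , s₁q<s₁z , s₁z≤s₁s₂) =
    y , z , σ , <<⇒StrictBetween s₁ s₁y<s₁q s₁q<s₁z , s₁y<s₁q ,
    +-cancelʳ-< (cw s₁ q) 0 (cw q z) (subst (cw s₁ q <_) (sym qz) s₁q<s₁z) ,
    +-cancelʳ-≤ (cw s₁ q) (cw q z) (cw q s₂) (subst₂ _≤_ (sym qz) (sym (cw-trans s₁ q s₂ (<⇒≤ s₁q<s₁s₂))) s₁z≤s₁s₂)
    where
    qz : cw q z + cw s₁ q ≡ cw s₁ z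
    qz = cw-trans s₁ q z (<⇒≤ s₁q<s₁z)

module _ {n : ℕ} {T : Tiling n} where

  predecessor-side-shorter : ∀ {P : Subset n} {v w p pp : Fin n} → IsTile T P →
    NextIn P v w → NextIn P p v → NextIn P pp p → cw pp p < cw w v
  predecessor-side-shorter {v = v} {w} {p} {pp} tP vw pv ppp
    with predecessors-ordered w tP vw (subst (_≤ cw w v) (sym (cw-refl w)) z≤n) pv ppp
  ... | _ , wpp<wp , wp<wv = ≤-<-trans (m≤m+n (cw pp p) (cw w pp))
    (subst (_< cw w v) (sym (cw-trans w pp p (<⇒≤ wpp<wp))) wp<wv)

  Path-end : ∀ {P : Subset n} {v y p pp : Fin n} (r : Fin n) → Path T P v y → NextIn P p v → NextIn P pp p →
    cw r pp ≤ cw r p → (y ≡ p) ⊎ (cw r pp < cw r y × cw r y < cw r p)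
  Path-end r (stop pv' _ _) pv ppp rpp≤rp = inj₁ (NextIn-injective pv' pv)
  Path-end r (step pv' ppp' _ tP' p→pp rest) pv ppp rpp≤rp with NextIn-injective pv' pv
  ... | refl with NextIn-injective ppp' ppp
  ...   | refl = inj₂ (Path-end-between r rest tP' p→pp rpp≤rp)

module _ {n : ℕ} {T : Tiling n} (tT : IsTiling T) where

  tile-across : ∀ {a b : Fin n} → InT T b a → Σ (Subset n) λ Q → IsTile T Q × NextIn Q a b
  tile-across {a} {b} b-a = tile-behind tT a b (inj₂ (InT-sym b-a)) (IsDiagonal⇒2≤cw (InT⇒IsDiagonal tT b-a))

  Path-exists : (k : ℕ) (P : Subset n) → IsTile T P → (v w : Fin n) → NextIn P v w → cw w v < k →
    Σ (Fin n) λ y → Path T P v y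
  Path-exists (suc k) P tP v w vw wv<1+k
    with NextIn-exists⁻ P (source∈ vw) (target∈ vw) (≢-sym (source≢target vw))
  ... | p , pv with NextIn-exists⁻ P (source∈ pv) (target∈ pv) (≢-sym (source≢target pv))
  ...   | pp , ppp with cw pp p ≟ 1
  ...     | yes boundary = p , stop pv ppp boundary
  ...     | no not-boundary = continue (tile-across pp-p)
    where
    pp-p : InT T pp p
    pp-p = tile-side tP ppp not-boundary
    continue : (Σ (Subset n) λ P' → IsTile T P' × NextIn P' p pp) → Σ (Fin n) λ y → Path T P v y
    continue (P' , tP' , p→pp) =
      let y , rest = Path-exists k P' tP' p pp p→pp (<-≤-trans (predecessor-side-shorter tP vw pv ppp) (s≤s⁻¹ wv<1+k))
      in y , step pv ppp pp-p tP' p→pp rest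

  private
    -- P is the tile across v → w; its strand segment at u (entering through u → u') leaves through w → v.
    module Backward {P : Subset n} {v w u u' : Fin n} (tP : IsTile T P)
                    (wv : NextIn P w v) (vu : NextIn P v u) (uu' : NextIn P u u') where
      vu<vw : cw v u < cw v w
      vu<vw = ≤∧≢⇒< (NextIn⇒arc wv (target∈ vu))
        (λ e → NextIn-asym tP (subst (NextIn P v) (cw-injective v e) vu) wv)

      vu'≤vw : cw v u' ≤ cw v w
      vu'≤vw = NextIn⇒arc wv (target∈ uu')

      vu<vu' : cw v u < cw v u'
      vu<vu' = NextIn⇒< v uu' (source∈ wv) vu<vw

      shorter : cw u u' < cw v w
      shorter = <-≤-trans (subst (cw u u' <_) (cw-trans v u u' (<⇒≤ vu<vu')) (m<m+n (cw u u') (≢⇒0<cw (source≢target vu))))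
                          vu'≤vw

      start-bound : ∀ {y : Fin n} → cw u y < cw u u' → cw v y < cw v w
      start-bound {y} uy<uu' with cw-triangle v u y
      ... | inj₁ e = <-≤-trans (subst₂ _<_ e (cw-trans v u u' (<⇒≤ vu<vu')) (+-monoˡ-< (cw v u) uy<uu')) vu'≤vw
      ... | inj₂ e = ⊥-elim (<⇒≱ (cw<n v u') (≤-trans (m≤n+m n (cw v y))
              (subst₂ _≤_ e (cw-trans v u u' (<⇒≤ vu<vu')) (<⇒≤ (+-monoˡ-< (cw v u) uy<uu')))))

  Strand-through : ∀ {z : Fin n} (k : ℕ) (P : Subset n) → IsTile T P → (v w : Fin n) → NextIn P v w → cw v w < k →
    Path T P v z → Σ (Fin n) λ y → Strand T y z × cw v y < cw v w
  Strand-through {z} (suc k) P tP v w vw vw<1+k path with cw v w ≟ 1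
  ... | yes boundary = v , strand P tP w vw boundary path ,
        subst (_< cw v w) (sym (cw-refl v)) (≢⇒0<cw (source≢target vw))
  ... | no not-boundary = continue (tile-across v-w)
    where
    v-w : InT T v w
    v-w = tile-side tP vw not-boundary
    continue : (Σ (Subset n) λ P' → IsTile T P' × NextIn P' w v) → Σ (Fin n) λ y → Strand T y z × cw v y < cw v w
    continue (P' , tP' , wv) =
      let u , vu = NextIn-exists P' (target∈ wv) (source∈ wv) (source≢target wv)
          u' , uu' = NextIn-exists P' (target∈ vu) (source∈ vu) (source≢target vu)
          y , σ , uy<uu' = Strand-through k P' tP' u u' uu' (<-≤-trans (Backward.shorter tP' wv vu uu') (s≤s⁻¹ vw<1+k))
                                          (step vu wv (InT-sym v-w) tP vw path)
      in y , σ , Backward.start-bound tP' wv vu uu' uy<uu'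

  -- The strand through the segment of P at s₁ starts before the successor p₁ of s₁ in P and ends after
  -- the predecessor pp of s₂, while q lies between p₁ and pp.
  covering-strand-in-tile : ∀ {P : Subset n} {s₁ s₂ q : Fin n} → IsTile T P → NextIn P s₂ s₁ →
    StrictBetween s₁ q s₂ → q ∈ˢ P → CoveringStrand T s₁ s₂ q
  covering-strand-in-tile {P} {s₁} {s₂} {q} tP s₂s₁ (0<s₁q , s₁q<s₁s₂) qP
    with NextIn-exists P (target∈ s₂s₁) (source∈ s₂s₁) (source≢target s₂s₁)
  ... | p₁ , s₁p₁ with NextIn-exists⁻ P (source∈ s₂s₁) (target∈ s₂s₁) (≢-sym (source≢target s₂s₁))
  ...   | pp , pps₂ with Path-exists (suc n) P tP s₁ p₁ s₁p₁ (s≤s (<⇒≤ (cw<n p₁ s₁)))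
  ...     | z , path with Strand-through (suc n) P tP s₁ p₁ s₁p₁ (s≤s (<⇒≤ (cw<n s₁ p₁))) path
  ...       | y , σ , s₁y<s₁p₁ = y , z , σ , <-≤-trans s₁y<s₁p₁ s₁p₁≤s₁q , s₁q<s₁z , s₁z≤s₁s₂
    where
    s₁p₁≤s₁q : cw s₁ p₁ ≤ cw s₁ q
    s₁p₁≤s₁q with target-nearest s₁p₁ q qP
    ... | inj₁ e = ⊥-elim (<⇒≢ 0<s₁q (sym e))
    ... | inj₂ le = le
    s₁pp<s₁s₂ : cw s₁ pp < cw s₁ s₂
    s₁pp<s₁s₂ = ≤∧≢⇒< (NextIn⇒arc s₂s₁ (source∈ pps₂)) (λ e → source≢target pps₂ (cw-injective s₁ e))
    s₁q≤s₁pp : cw s₁ q ≤ cw s₁ pp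
    s₁q≤s₁pp = ≮⇒≥ λ s₁pp<s₁q → <⇒≱ s₁q<s₁s₂ (NextIn⇒≤ s₁ pps₂ s₁pp<s₁s₂ qP s₁pp<s₁q)
    z-end = Path-end s₁ path s₂s₁ pps₂ (<⇒≤ s₁pp<s₁s₂)
    s₁q<s₁z : cw s₁ q < cw s₁ z
    s₁q<s₁z with z-end
    ... | inj₁ refl = s₁q<s₁s₂
    ... | inj₂ (s₁pp<s₁z , _) = ≤-<-trans s₁q≤s₁pp s₁pp<s₁z
    s₁z≤s₁s₂ : cw s₁ z ≤ cw s₁ s₂
    s₁z≤s₁s₂ with z-end
    ... | inj₁ refl = ≤-refl
    ... | inj₂ (_ , s₁z<s₁s₂) = <⇒≤ s₁z<s₁s₂

  side-within-arc : ∀ {P : Subset n} {s₁ s₂ q c d : Fin n} → IsTile T P → NextIn P s₂ s₁ →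
    StrictBetween s₁ q s₂ → NextIn P c d → StrictBetween c q d →
    cw s₁ c < cw s₁ d × cw s₁ d ≤ cw s₁ s₂ × cw c d < cw s₁ s₂
  side-within-arc {P} {s₁} {s₂} {q} {c} {d} tP s₂s₁ (_ , s₁q<s₁s₂) cd cqd = s₁c<s₁d , s₁d≤s₁s₂ , shorter
    where
    c≢s₂ : c ≢ s₂
    c≢s₂ refl with NextIn-functional cd s₂s₁
    ... | refl = <⇒≱ s₁q<s₁s₂ (<⇒≤ (StrictBetween⇒cw< {a = s₁} {s₂} {q} cqd))
    s₁c<s₁s₂ : cw s₁ c < cw s₁ s₂
    s₁c<s₁s₂ = ≤∧≢⇒< (NextIn⇒arc s₂s₁ (source∈ cd)) (λ e → c≢s₂ (cw-injective s₁ e))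
    s₁d≤s₁s₂ : cw s₁ d ≤ cw s₁ s₂
    s₁d≤s₁s₂ = NextIn⇒arc s₂s₁ (target∈ cd)
    s₁c<s₁d : cw s₁ c < cw s₁ d
    s₁c<s₁d = NextIn⇒< s₁ cd (source∈ s₂s₁) s₁c<s₁s₂
    shorter : cw c d < cw s₁ s₂
    shorter with cw s₁ c ≟ 0
    ... | no s₁c≢0 = <-≤-trans (subst (cw c d <_) (cw-trans s₁ c d (<⇒≤ s₁c<s₁d)) (m<m+n (cw c d) (n≢0⇒n>0 s₁c≢0)))
                               s₁d≤s₁s₂
    ... | yes s₁c≡0 with cw≡0⇒≡ {a = s₁} {c} s₁c≡0
    ...   | refl = ≤∧≢⇒< s₁d≤s₁s₂ λ e → NextIn-asym tP (subst (NextIn P s₁) (cw-injective s₁ e) cd) s₂s₁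

  covering-strand-by-length : (k : ℕ) {s₁ s₂ q : Fin n} → InT T s₁ s₂ → cw s₁ s₂ < k → StrictBetween s₁ q s₂ →
    CoveringStrand T s₁ s₂ q
  covering-strand-by-length (suc k) {s₁} {s₂} {q} s₁-s₂ s₁s₂<1+k s₁qs₂ = across (tile-across s₁-s₂)
    where
    across : (Σ (Subset n) λ P → IsTile T P × NextIn P s₂ s₁) → CoveringStrand T s₁ s₂ q
    across (P , tP , s₂s₁) with q ∈? P
    ... | yes qP = covering-strand-in-tile tP s₂s₁ s₁qs₂ qP
    ... | no q∉P = behind (vertex-behind-side tP q∉P)
      where
      behind : (Σ (Fin n) λ c → Σ (Fin n) λ d → NextIn P c d × StrictBetween c q d) → CoveringStrand T s₁ s₂ q
      behind (c , d , cd , cqd) =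
        let s₁c<s₁d , s₁d≤s₁s₂ , cd<s₁s₂ = side-within-arc {P = P} {s₁} {s₂} {q} {c} {d} tP s₂s₁ s₁qs₂ cd cqd
        in CoveringStrand-widen {s₁ = s₁} {s₂} {c} {d} {q} (<⇒≤ s₁c<s₁d) s₁d≤s₁s₂
             (covering-strand-by-length k {c} {d} {q} (side-with-vertex-behind∈T {P = P} {c} {d} {q} tP cd cqd)
                                          (<-≤-trans cd<s₁s₂ (s≤s⁻¹ s₁s₂<1+k)) cqd)

mainTheorem14 : ∀ {n} → 3 ≤ n → (T : Tiling n) → IsTiling T →
    (s₁ s₂ : Fin n) → InT T s₁ s₂ → (q : Fin n) → StrictBetween s₁ q s₂ →
    (Σ (Fin n) λ y → Σ (Fin n) λ z →
       Strand T y z × Covers y q z × InCO s₁ q y × InOC q s₂ z)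
    ×
    (∀ y z → Strand T y z → Covers y q z → InCO s₁ q y → InOC q s₂ z →
       (T' : Tiling n) → IsTiling T' → (Q : Subset n) → IsTile T' Q →
       MeetsInSegment Q s₁ s₂ → q ∈ˢ Q →
       (σ : Strand T' y z) → LongFor σ Q)
mainTheorem14 {n} _ T tT s₁ s₂ s₁-s₂ q s₁qs₂ =
  CoveringStrand⇒covers {s₁ = s₁} {s₂} {q} s₁qs₂
    (covering-strand-by-length tT (suc n) {s₁} {s₂} {q} s₁-s₂ (s≤s (<⇒≤ (cw<n s₁ s₂))) s₁qs₂) ,
  λ y z _ yqz s₁≤y<q q<z≤s₂ T' tT' Q tQ meets qQ σ →
    let u , uQ , u-uncovered = MeetsInSegment⇒uncovered-vertex {Q = Q} {s₁} {q} {s₂} {y} {z} s₁qs₂ s₁≤y<q q<z≤s₂ meets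
    in Strand-crosses-tile tT' tQ σ qQ yqz uQ u-uncovered
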